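{- For $p\in\{120,101\}$: $\sum_{n\geq 0}|\mathcal{C}_n(p)|x^n=\frac{1-2x}{1-3x+x^2}$, and for $n\geq 1$ the coefficient $|\mathcal{C}_n(p)|$ equals the Fibonacci number $F_{2n-1}$ (with $F_1=F_2=1$, $F_{m}=F_{m-1}+F_{m-2}$). Moreover, for every $n\geq 0$ the popularity of descents $\sum_{w\in\mathcal{C}_n(p)}d(w)$ equals $\sum_{k=1}^{n-2}k\binom{n+k-2}{2k}$, which is the coefficient of $x^n$ in $\frac{x^3(1-x)}{(1-3x+x^2)^2}$.
   Context: A Catalan word of length $n\geq 1$ is a word $w_1\ldots w_n$ over the non-negative integers with $w_1=0$ and $0\leq w_i\leq w_{i-1}+1$ for $2\leq i\leq n$; the empty word is the unique Catalan word of length $0$. A word $w$ contains the pattern $p=p_1\ldots p_k$ if there are indices $i_1<\cdots<i_k$ such that $w_{i_1}\ldots w_{i_k}$ is order-isomorphic to $p$ (for all $a,b$: $w_{i_a}<w_{i_b}$ iff $p_a<p_b$, and $w_{i_a}=w_{i_b}$ iff $p_a=p_b$); otherwise $w$ avoids $p$. $\mathcal{C}_n(p)$ is the set of Catalan words of length $n$ avoiding $p$. A descent of $w$ is an index $i$ with $w_i>w_{i+1}$; $d(w)$ denotes the number of descents of $w$. Empty sums are $0$. -}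

module Defs where

open import Data.Bool using (Bool; true; false; _∧_; not; if_then_else_)
open import Data.Bool.Properties using () renaming (_≟_ to _≟ᵇ_)
open import Data.Nat using (ℕ; zero; suc; _+_; _*_; _∸_; _<ᵇ_; _≡ᵇ_; _≤ᵇ_)
open import Data.Nat.Combinatorics using (_C_)
open import Data.List using (List; []; _∷_; map; concatMap; filterᵇ; length; upTo; zip)
open import Data.Bool.ListAction using (all; any)
open import Data.Nat.ListAction using (sum)
open import Data.Product using (_×_; _,_)
open import Data.Integer as ℤ using (ℤ)
open import Relation.Binary.PropositionalEquality using (_≡_)

catStep : ℕ → List ℕ → Bool
catStep prev []       = true
catStep prev (y ∷ ys) = (y ≤ᵇ suc prev) ∧ catStep y ys

isCatalan : List ℕ → Bool
isCatalan []       = true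
isCatalan (x ∷ xs) = (x ≡ᵇ 0) ∧ catStep x xs

subseqs : List ℕ → List (List ℕ)
subseqs []       = [] ∷ []
subseqs (x ∷ xs) = let r = subseqs xs in map (x ∷_) r Data.List.++ r

_==ᵇ_ : Bool → Bool → Bool
true  ==ᵇ b = b
false ==ᵇ b = not b

orderIso : List ℕ → List ℕ → Bool
orderIso s p =
  (length s ≡ᵇ length p) ∧
  all (λ { (a , b) → all (λ { (c , d) → ((a <ᵇ c) ==ᵇ (b <ᵇ d)) ∧ ((a ≡ᵇ c) ==ᵇ (b ≡ᵇ d)) }) prs }) prs
  where prs = zip s p

contains : List ℕ → List ℕ → Bool
contains w p = any (λ s → orderIso s p) (subseqs w)

wordsOver : ℕ → ℕ → List (List ℕ)
wordsOver b zero    = [] ∷ []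
wordsOver b (suc n) = concatMap (λ x → map (x ∷_) (wordsOver b n)) (upTo b)

-- 𝒞ₙ(p): Catalan words of length n avoiding p (every letter of a
-- Catalan word of length n is ≤ n-1 < n, so wordsOver n n contains all of them).
Cat : ℕ → List ℕ → List (List ℕ)
Cat n p = filterᵇ (λ w → isCatalan w ∧ not (contains w p)) (wordsOver n n)

des : List ℕ → ℕ
des []           = 0
des (x ∷ [])     = 0
des (x ∷ y ∷ ys) = (if y <ᵇ x then 1 else 0) + des (y ∷ ys)

fib : ℕ → ℕ
fib zero          = 0
fib (suc zero)    = 1
fib (suc (suc n)) = fib (suc n) + fib n

-- Σ_{k=1}^{n-2} k · C(n+k-2, 2k)  (empty sum = 0 when n < 3)
descentSum : ℕ → ℕ
descentSum n = sum (map (λ i → let k = suc i in k * ((n + k ∸ 2) C (2 * k))) (upTo (n ∸ 2)))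

-- Polynomials over ℤ as coefficient lists (lowest degree first).
coeff : List ℤ → ℕ → ℤ
coeff []       _       = ℤ.0ℤ
coeff (c ∷ cs) zero    = c
coeff (c ∷ cs) (suc j) = coeff cs j

polyAdd : List ℤ → List ℤ → List ℤ
polyAdd []       q        = q
polyAdd p        []       = p
polyAdd (a ∷ p)  (b ∷ q)  = (a ℤ.+ b) ∷ polyAdd p q

polyMul : List ℤ → List ℤ → List ℤ
polyMul []      q = []
polyMul (a ∷ p) q = polyAdd (map (a ℤ.*_) q) (ℤ.0ℤ ∷ polyMul p q)

-- hasGF a P Q : the formal power series Σ a(n) xⁿ equals P(x)/Q(x),
-- i.e. (Σ a(n) xⁿ) · Q(x) = P(x) coefficientwise:
-- for all n, Σ_{j=0}^{n} Q_j · a(n-j) = P_n.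
sumℤ : List ℤ → ℤ
sumℤ []       = ℤ.0ℤ
sumℤ (x ∷ xs) = x ℤ.+ sumℤ xs

hasGF : (ℕ → ℤ) → List ℤ → List ℤ → Set
hasGF a P Q = ∀ n → sumℤ (map (λ j → coeff Q j ℤ.* a (n ∸ j)) (upTo (suc n))) ≡ coeff P n

-- A Catalan word avoiding p ∈ {120, 101} is built letter by letter after its initial 0, and
-- which letters may be appended depends only on a small summary of the prefix. For 120 it is
-- the last letter v and the largest letter f followed by a larger one: the next letter must
-- lie in [f, v + 1]. For 101 it is the last letter and whether a strict descent has occurred:
-- afterwards only letters up to the last one remain. Counting completions state by state
-- yields, for both patterns, the recurrences A′ = A + B, B′ = A + 2B for the numbers of words
-- and C′ = C + E, E′ = C + 2E + A for their descents (for 101 after a Pascal-type identity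
-- among the completion counts of the ascending states). Then A m = F (2m + 1), Pascal's rule
-- identifies C (m + 1) with Σ k · C(m + k, 2k), and the generating functions follow from the linear
-- recurrences with characteristic polynomials 1 - 3x + x² and its square.
module Submission where

open import Defs
open import Data.Nat using (ℕ; _≤_; _*_; _∸_)
open import Data.List using (List; []; _∷_; length; map)
open import Data.Nat.ListAction using (sum)
open import Data.Integer using (+_; -_)
open import Data.Product using (_×_)
open import Data.Sum using (_⊎_)
open import Relation.Binary.PropositionalEquality using (_≡_)

open import Data.Nat using (zero; suc; _+_; _<_; _<ᵇ_; _≡ᵇ_; _≤ᵇ_; _⊔_; z≤n; s≤s; z<s; s<s)
open import Data.Nat.Properties
open import Data.Bool using (Bool; true; false; _∧_; _∨_; not; if_then_else_)
open import Data.Bool.Properties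
  using (∧-conicalˡ; ∧-conicalʳ; ∧-assoc; ∧-identityʳ; ∧-zeroʳ; ∧-distribʳ-∨; ∨-assoc; ∨-identityʳ; T-≡;
         ∧-commutativeMonoid; ∨-commutativeMonoid; ∨-∧-booleanAlgebra; not-injective)
open import Algebra.Bundles using (CommutativeMonoid)
open import Algebra.Lattice.Properties.BooleanAlgebra ∨-∧-booleanAlgebra using (deMorgan₂)
open import Algebra.Properties.CommutativeSemigroup (CommutativeMonoid.commutativeSemigroup ∨-commutativeMonoid)
  using () renaming (interchange to ∨-interchange)
open import Algebra.Properties.CommutativeSemigroup (CommutativeMonoid.commutativeSemigroup ∧-commutativeMonoid)
  using () renaming (interchange to ∧-interchange)
open import Algebra.Properties.CommutativeSemigroup ⊔-commutativeSemigroup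
  using () renaming (interchange to ⊔-interchange)
open import Algebra.Properties.CommutativeSemigroup +-commutativeSemigroup
  using () renaming (interchange to +-interchange)
open import Data.Bool.ListAction using (any)
open import Data.List using (_++_; applyUpTo; upTo; concatMap; filterᵇ; [_])
open import Data.List.Properties using (map-∘; map-cong; map-++; ++-assoc; ++-identityʳ)
open import Data.Nat.ListAction.Properties using (sum-++)
open import Data.Product using (_,_; proj₁; proj₂)
open import Data.Sum using (inj₁; inj₂)
open import Function using (_∘_; Equivalence)
open import Relation.Nullary using (contradiction; yes; no)
open import Data.Nat.Combinatorics using (_C_; k>n⇒nCk≡0; nCk+nC[k+1]≡[n+1]C[k+1])
open import Relation.Binary.Definitions using (tri<; tri≈; tri>)
open import Relation.Binary.PropositionalEquality using (_≢_; refl; sym; trans; cong; cong₂; subst; module ≡-Reasoning)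
open import Data.Nat.Tactic.RingSolver using (solve-∀)
open import Data.Integer.Tactic.RingSolver using () renaming (solve-∀ to solveℤ-∀)
import Data.Integer as ℤ
import Data.Integer.Properties as ℤₚ
open ℤ using (ℤ)

<⇒<ᵇ≡true : ∀ {m n} → m < n → (m <ᵇ n) ≡ true
<⇒<ᵇ≡true m<n = Equivalence.to T-≡ (<⇒<ᵇ m<n)

<ᵇ≡true⇒< : ∀ {m n} → (m <ᵇ n) ≡ true → m < n
<ᵇ≡true⇒< {m} {n} e = <ᵇ⇒< m n (Equivalence.from T-≡ e)

≥⇒<ᵇ≡false : ∀ {m n} → n ≤ m → (m <ᵇ n) ≡ false
≥⇒<ᵇ≡false {m} {n} n≤m with m <ᵇ n in e
... | true  = contradiction (<ᵇ≡true⇒< e) (≤⇒≯ n≤m)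
... | false = refl

<ᵇ≡false⇒≥ : ∀ {m n} → (m <ᵇ n) ≡ false → n ≤ m
<ᵇ≡false⇒≥ e = ≮⇒≥ (λ m<n → contradiction (trans (sym e) (<⇒<ᵇ≡true m<n)) λ ())

<ᵇ-irrefl : ∀ m → (m <ᵇ m) ≡ false
<ᵇ-irrefl m = ≥⇒<ᵇ≡false {m} ≤-refl

≤⇒≤ᵇ≡true : ∀ {m n} → m ≤ n → (m ≤ᵇ n) ≡ true
≤⇒≤ᵇ≡true m≤n = Equivalence.to T-≡ (≤⇒≤ᵇ m≤n)

≤ᵇ≡true⇒≤ : ∀ {m n} → (m ≤ᵇ n) ≡ true → m ≤ n
≤ᵇ≡true⇒≤ {m} {n} e = ≤ᵇ⇒≤ m n (Equivalence.from T-≡ e)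

>⇒≤ᵇ≡false : ∀ {m n} → n < m → (m ≤ᵇ n) ≡ false
>⇒≤ᵇ≡false {suc m} (s≤s n≤m) = ≥⇒<ᵇ≡false n≤m

≡ᵇ≡true⇒≡ : ∀ {m n} → (m ≡ᵇ n) ≡ true → m ≡ n
≡ᵇ≡true⇒≡ {m} {n} e = ≡ᵇ⇒≡ m n (Equivalence.from T-≡ e)

≡⇒≡ᵇ≡true : ∀ {m n} → m ≡ n → (m ≡ᵇ n) ≡ true
≡⇒≡ᵇ≡true {m} {n} m≡n = Equivalence.to T-≡ (≡⇒≡ᵇ m n m≡n)

≢⇒≡ᵇ≡false : ∀ {m n} → m ≢ n → (m ≡ᵇ n) ≡ false
≢⇒≡ᵇ≡false {m} {n} m≢n with m ≡ᵇ n in e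
... | true  = contradiction (≡ᵇ≡true⇒≡ e) m≢n
... | false = refl

boolToℕ : Bool → ℕ
boolToℕ b = if b then 1 else 0

if-true : ∀ {c} {x y : ℕ} → c ≡ true → (if c then x else y) ≡ x
if-true refl = refl

if-false : ∀ {c} {x y : ℕ} → c ≡ false → (if c then x else y) ≡ y
if-false refl = refl

∑< : ℕ → (ℕ → ℕ) → ℕ
∑< zero    g = 0
∑< (suc n) g = g 0 + ∑< n (g ∘ suc)

syntax ∑< n (λ k → e) = ∑[ k < n ] e

sum-map-applyUpTo : ∀ (f g : ℕ → ℕ) n → sum (map g (applyUpTo f n)) ≡ ∑[ k < n ] g (f k)
sum-map-applyUpTo f g zero    = refl
sum-map-applyUpTo f g (suc n) = cong (_+_ (g (f 0))) (sum-map-applyUpTo (f ∘ suc) g n)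

∑<-cong : ∀ n {g h : ℕ → ℕ} → (∀ k → k < n → g k ≡ h k) → ∑< n g ≡ ∑< n h
∑<-cong zero    eq = refl
∑<-cong (suc n) eq = cong₂ _+_ (eq 0 z<s) (∑<-cong n (λ k k<n → eq (suc k) (s<s k<n)))

∑<-zero : ∀ n {g : ℕ → ℕ} → (∀ k → k < n → g k ≡ 0) → ∑< n g ≡ 0
∑<-zero zero    eq = refl
∑<-zero (suc n) eq = cong₂ _+_ (eq 0 z<s) (∑<-zero n (λ k k<n → eq (suc k) (s<s k<n)))

∑<-distrib-+ : ∀ n (g h : ℕ → ℕ) → ∑[ k < n ] (g k + h k) ≡ ∑< n g + ∑< n h
∑<-distrib-+ zero    g h = refl
∑<-distrib-+ (suc n) g h = begin
  (g 0 + h 0) + ∑[ k < n ] (g (suc k) + h (suc k))       ≡⟨ cong (_+_ (g 0 + h 0)) (∑<-distrib-+ n (g ∘ suc) (h ∘ suc)) ⟩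
  (g 0 + h 0) + (∑< n (g ∘ suc) + ∑< n (h ∘ suc))        ≡⟨ +-interchange (g 0) (h 0) _ _ ⟩
  (g 0 + ∑< n (g ∘ suc)) + (h 0 + ∑< n (h ∘ suc))        ∎
  where open ≡-Reasoning

∑<-distribˡ-* : ∀ n c (g : ℕ → ℕ) → ∑[ k < n ] (c * g k) ≡ c * ∑< n g
∑<-distribˡ-* zero    c g = sym (*-zeroʳ c)
∑<-distribˡ-* (suc n) c g =
  trans (cong (_+_ (c * g 0)) (∑<-distribˡ-* n c (g ∘ suc))) (sym (*-distribˡ-+ c (g 0) _))

∑<-suc : ∀ n (g : ℕ → ℕ) → ∑< (suc n) g ≡ ∑< n g + g n
∑<-suc zero    g = +-identityʳ (g 0)
∑<-suc (suc n) g = trans (cong (_+_ (g 0)) (∑<-suc n (g ∘ suc))) (sym (+-assoc (g 0) _ _))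

∑<-truncate : ∀ {b n} (g : ℕ → ℕ) → n ≤ b → (∀ k → n ≤ k → g k ≡ 0) → ∑< b g ≡ ∑< n g
∑<-truncate {b} {n} g n≤b vanish = begin
  ∑< b g                          ≡⟨ cong (λ x → ∑< x g) (sym (m+[n∸m]≡n n≤b)) ⟩
  ∑< (n + (b ∸ n)) g              ≡⟨ split n ⟩
  ∑< n g + ∑[ k < b ∸ n ] g (n + k) ≡⟨ cong (_+_ (∑< n g)) (∑<-zero (b ∸ n) (λ k _ → vanish (n + k) (m≤m+n n k))) ⟩
  ∑< n g + 0                      ≡⟨ +-identityʳ _ ⟩
  ∑< n g                          ∎
  where
  open ≡-Reasoning
  split : ∀ {g : ℕ → ℕ} {m} i → ∑< (i + m) g ≡ ∑< i g + ∑[ k < m ] g (i + k)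
  split          zero    = refl
  split {g} {m} (suc i) = trans (cong (_+_ (g 0)) (split {g ∘ suc} i)) (sym (+-assoc (g 0) _ (∑< m (g ∘ _+_ (suc i)))))

∑<-interval : ∀ {b} lo n (g : ℕ → ℕ) → n + lo ≤ b → (∀ y → y < lo → g y ≡ 0) → (∀ y → n + lo ≤ y → g y ≡ 0) →
              ∑< b g ≡ ∑[ k < n ] g (k + lo)
∑<-interval lo n g bound below above = trans (∑<-truncate g bound above) (shift n)
  where
  shift : ∀ n → ∑< (n + lo) g ≡ ∑[ k < n ] g (k + lo)
  shift zero    = ∑<-zero lo below
  shift (suc n) = begin
    ∑< (suc (n + lo)) g              ≡⟨ ∑<-suc (n + lo) g ⟩
    ∑< (n + lo) g + g (n + lo)        ≡⟨ cong (_+ g (n + lo)) (shift n) ⟩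
    ∑[ k < n ] g (k + lo) + g (n + lo) ≡⟨ sym (∑<-suc n (λ k → g (k + lo))) ⟩
    ∑[ k < suc n ] g (k + lo)         ∎
    where open ≡-Reasoning

shift-< : ∀ v {m b} → v + suc m < b → suc v + m < b
shift-< v {m} {b} = subst (_< b) (+-suc v m)

drop-< : ∀ v {m b} → suc v + m < b → v + m < b
drop-< v {m} = <-trans (n<1+n (v + m))

2+≤ : ∀ v {m b} → v + suc m < b → suc (suc v) ≤ b
2+≤ v {m} lt = ≤-trans (s≤s (s≤s (m≤m+n v m))) (shift-< v lt)

∑words : ℕ → ℕ → (List ℕ → ℕ) → ℕ
∑words b n h = sum (map h (wordsOver b n))

∑words-cong : ∀ b n {h h′ : List ℕ → ℕ} → (∀ w → h w ≡ h′ w) → ∑words b n h ≡ ∑words b n h′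
∑words-cong b n eq = cong sum (map-cong eq (wordsOver b n))

∑words-zero : ∀ b n {h : List ℕ → ℕ} → (∀ w → h w ≡ 0) → ∑words b n h ≡ 0
∑words-zero b n {h} eq = zeros (wordsOver b n)
  where
  zeros : ∀ ws → sum (map h ws) ≡ 0
  zeros []       = refl
  zeros (w ∷ ws) = cong₂ _+_ (eq w) (zeros ws)

∑words-suc : ∀ b n h → ∑words b (suc n) h ≡ ∑[ x < b ] ∑words b n (h ∘ (x ∷_))
∑words-suc b n h = begin
  sum (map h (concatMap extend (upTo b)))                    ≡⟨ sum-concatMap (upTo b) ⟩
  sum (map (λ x → sum (map h (extend x))) (upTo b))
    ≡⟨ cong sum (map-cong (λ x → cong sum (sym (map-∘ (wordsOver b n)))) (upTo b)) ⟩
  sum (map (λ x → ∑words b n (h ∘ (x ∷_))) (upTo b))         ≡⟨ sum-map-applyUpTo (λ k → k) _ b ⟩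
  ∑[ x < b ] ∑words b n (h ∘ (x ∷_))                         ∎
  where
  open ≡-Reasoning
  extend : ℕ → List (List ℕ)
  extend x = map (x ∷_) (wordsOver b n)
  sum-concatMap : ∀ xs → sum (map h (concatMap extend xs)) ≡ sum (map (λ x → sum (map h (extend x))) xs)
  sum-concatMap []       = refl
  sum-concatMap (x ∷ xs) = begin
    sum (map h (extend x ++ concatMap extend xs))              ≡⟨ cong sum (map-++ h (extend x) _) ⟩
    sum (map h (extend x) ++ map h (concatMap extend xs))      ≡⟨ sum-++ (map h (extend x)) _ ⟩
    sum (map h (extend x)) + sum (map h (concatMap extend xs)) ≡⟨ cong (_+_ _) (sum-concatMap xs) ⟩
    _                                                         ∎

sum-map-filterᵇ : ∀ (f : List ℕ → ℕ) (P : List ℕ → Bool) ws →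
                  sum (map f (filterᵇ P ws)) ≡ sum (map (λ w → if P w then f w else 0) ws)
sum-map-filterᵇ f P []       = refl
sum-map-filterᵇ f P (w ∷ ws) with P w
... | true  = cong (_+_ (f w)) (sum-map-filterᵇ f P ws)
... | false = sum-map-filterᵇ f P ws

length-filterᵇ : ∀ (P : List ℕ → Bool) ws → length (filterᵇ P ws) ≡ sum (map (boolToℕ ∘ P) ws)
length-filterᵇ P []       = refl
length-filterᵇ P (w ∷ ws) with P w
... | true  = cong suc (length-filterᵇ P ws)
... | false = length-filterᵇ P ws

anyPair : (ℕ → ℕ → Bool) → List ℕ → Bool
anyPair g []       = false
anyPair g (x ∷ xs) = any (g x) xs ∨ anyPair g xs

anyTriple : (ℕ → ℕ → ℕ → Bool) → List ℕ → Bool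
anyTriple t []       = false
anyTriple t (x ∷ xs) = anyPair (t x) xs ∨ anyTriple t xs

any-subseqs-∷ : ∀ (g : List ℕ → Bool) x xs →
                any g (subseqs (x ∷ xs)) ≡ any (g ∘ (x ∷_)) (subseqs xs) ∨ any g (subseqs xs)
any-subseqs-∷ g x xs = trans (any-++ (map (x ∷_) (subseqs xs))) (cong (_∨ any g (subseqs xs)) (any-map (subseqs xs)))
  where
  any-++ : ∀ ss {ts} → any g (ss ++ ts) ≡ any g ss ∨ any g ts
  any-++ []       = refl
  any-++ (s ∷ ss) = trans (cong (g s ∨_) (any-++ ss)) (sym (∨-assoc (g s) _ _))
  any-map : ∀ ss → any g (map (x ∷_) ss) ≡ any (g ∘ (x ∷_)) ss
  any-map []       = refl
  any-map (s ∷ ss) = cong (g (x ∷ s) ∨_) (any-map ss)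

any-subseqs-nil : ∀ (g : List ℕ → Bool) → (∀ a s → g (a ∷ s) ≡ false) →
                  ∀ w → any g (subseqs w) ≡ g []
any-subseqs-nil g long []       = ∨-identityʳ (g [])
any-subseqs-nil g long (x ∷ xs) = trans (any-subseqs-∷ g x xs)
  (cong₂ _∨_ (trans (any-subseqs-nil (g ∘ (x ∷_)) (λ a s → long x (a ∷ s)) xs) (long x [])) (any-subseqs-nil g long xs))

any-subseqs-singleton : ∀ (g : List ℕ → Bool) f → g [] ≡ false → (∀ a → g [ a ] ≡ f a) →
                        (∀ a b s → g (a ∷ b ∷ s) ≡ false) → ∀ w → any g (subseqs w) ≡ any f w
any-subseqs-singleton g f nil one long []       = trans (∨-identityʳ (g [])) nil
any-subseqs-singleton g f nil one long (x ∷ xs) = trans (any-subseqs-∷ g x xs)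
  (cong₂ _∨_ (trans (any-subseqs-nil (g ∘ (x ∷_)) (long x) xs) (one x)) (any-subseqs-singleton g f nil one long xs))

any-subseqs-pair : ∀ (g : List ℕ → Bool) f → g [] ≡ false → (∀ a → g [ a ] ≡ false) →
                   (∀ a b → g (a ∷ b ∷ []) ≡ f a b) → (∀ a b c s → g (a ∷ b ∷ c ∷ s) ≡ false) →
                   ∀ w → any g (subseqs w) ≡ anyPair f w
any-subseqs-pair g f nil one two long []       = trans (∨-identityʳ (g [])) nil
any-subseqs-pair g f nil one two long (x ∷ xs) = trans (any-subseqs-∷ g x xs)
  (cong₂ _∨_ (any-subseqs-singleton (g ∘ (x ∷_)) (f x) (one x) (two x) (long x) xs)
             (any-subseqs-pair g f nil one two long xs))

any-subseqs-triple : ∀ (g : List ℕ → Bool) t → g [] ≡ false → (∀ a → g [ a ] ≡ false) →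
                     (∀ a b → g (a ∷ b ∷ []) ≡ false) → (∀ a b c → g (a ∷ b ∷ c ∷ []) ≡ t a b c) →
                     (∀ a b c d s → g (a ∷ b ∷ c ∷ d ∷ s) ≡ false) → ∀ w → any g (subseqs w) ≡ anyTriple t w
any-subseqs-triple g t nil one two three long []       = trans (∨-identityʳ (g [])) nil
any-subseqs-triple g t nil one two three long (x ∷ xs) = trans (any-subseqs-∷ g x xs)
  (cong₂ _∨_ (any-subseqs-pair (g ∘ (x ∷_)) (t x) (one x) (two x) (three x) (long x) xs)
             (any-subseqs-triple g t nil one two three long xs))

contains-triple : ∀ {p q r} (t : ℕ → ℕ → ℕ → Bool) →
                  (∀ a b c → orderIso (a ∷ b ∷ c ∷ []) (p ∷ q ∷ r ∷ []) ≡ t a b c) →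
                  ∀ w → contains w (p ∷ q ∷ r ∷ []) ≡ anyTriple t w
contains-triple {p} {q} {r} t iso = any-subseqs-triple (λ s → orderIso s (p ∷ q ∷ r ∷ [])) t
  refl (λ _ → refl) (λ _ _ → refl) iso (λ _ _ _ _ _ → refl)

agree : ℕ → ℕ → ℕ → ℕ → Bool
agree a b m n = ((a <ᵇ b) ==ᵇ (m <ᵇ n)) ∧ ((a ≡ᵇ b) ==ᵇ (m ≡ᵇ n))

==ᵇ-sound : ∀ {x y} → (x ==ᵇ y) ≡ true → x ≡ y
==ᵇ-sound {true}  {true}  _ = refl
==ᵇ-sound {false} {false} _ = refl

agree⇒<ᵇ≡ : ∀ {a b m n} → agree a b m n ≡ true → (a <ᵇ b) ≡ (m <ᵇ n)
agree⇒<ᵇ≡ h = ==ᵇ-sound (∧-conicalˡ _ _ h)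

agree⇒≡ᵇ≡ : ∀ {a b m n} → agree a b m n ≡ true → (a ≡ᵇ b) ≡ (m ≡ᵇ n)
agree⇒≡ᵇ≡ h = ==ᵇ-sound (∧-conicalʳ _ _ h)

agree-< : ∀ {a b m n} → a < b → m < n → agree a b m n ≡ true
agree-< a<b m<n rewrite <⇒<ᵇ≡true a<b | <⇒<ᵇ≡true m<n
                      | ≢⇒≡ᵇ≡false (<⇒≢ a<b) | ≢⇒≡ᵇ≡false (<⇒≢ m<n) = refl

agree-> : ∀ {a b m n} → b < a → n < m → agree a b m n ≡ true
agree-> b<a n<m rewrite ≥⇒<ᵇ≡false (<⇒≤ b<a) | ≥⇒<ᵇ≡false (<⇒≤ n<m)
                      | ≢⇒≡ᵇ≡false (>⇒≢ b<a) | ≢⇒≡ᵇ≡false (>⇒≢ n<m) = refl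

agree-≡ : ∀ {a b m n} → a ≡ b → m ≡ n → agree a b m n ≡ true
agree-≡ {a} {m = m} refl refl rewrite <ᵇ-irrefl a | <ᵇ-irrefl m | ≡⇒≡ᵇ≡true {a} refl | ≡⇒≡ᵇ≡true {m} refl = refl

Bool-ext : ∀ {x y} → (x ≡ true → y ≡ true) → (y ≡ true → x ≡ true) → x ≡ y
Bool-ext {true}  {true}  _ _ = refl
Bool-ext {true}  {false} f _ = sym (f refl)
Bool-ext {false} {true}  _ g = g refl
Bool-ext {false} {false} _ _ = refl

∧-split : ∀ x {y} → x ∧ y ≡ true → (x ≡ true) × (y ≡ true)
∧-split true h = refl , h

orderIso₃-sound : ∀ {a b c p q r} → orderIso (a ∷ b ∷ c ∷ []) (p ∷ q ∷ r ∷ []) ≡ true →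
                  (agree a b p q ≡ true) × (agree a c p r ≡ true) × (agree b c q r ≡ true) ×
                  (agree b a q p ≡ true) × (agree c a r p ≡ true) × (agree c b r q ≡ true)
orderIso₃-sound {a} {b} {c} {p} {q} {r} h = ab , ac , bc , ba , ca , cb
  where
  rowA = ∧-split (agree a a p p ∧ agree a b p q ∧ agree a c p r ∧ true) h
  rowB = ∧-split (agree b a q p ∧ agree b b q q ∧ agree b c q r ∧ true) (proj₂ rowA)
  rowC = ∧-split (agree c a r p ∧ agree c b r q ∧ agree c c r r ∧ true) (proj₂ rowB)
  restA = ∧-split (agree a b p q) (proj₂ (∧-split (agree a a p p) (proj₁ rowA)))
  restB = ∧-split (agree b a q p) (proj₁ rowB)
  restC = ∧-split (agree c a r p) (proj₁ rowC)
  ab = proj₁ restA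
  ac = proj₁ (∧-split (agree a c p r) (proj₂ restA))
  ba = proj₁ restB
  bc = proj₁ (∧-split (agree b c q r) (proj₂ (∧-split (agree b b q q) (proj₂ restB))))
  ca = proj₁ restC
  cb = proj₁ (∧-split (agree c b r q) (proj₂ restC))

orderIso₃-complete : ∀ {a b c p q r} →
                     agree a b p q ≡ true → agree a c p r ≡ true → agree b c q r ≡ true →
                     agree b a q p ≡ true → agree c a r p ≡ true → agree c b r q ≡ true →
                     orderIso (a ∷ b ∷ c ∷ []) (p ∷ q ∷ r ∷ []) ≡ true
orderIso₃-complete {a} {b} {c} {p} {q} {r} ab ac bc ba ca cb =
  cong₂ _∧_ (cong₂ _∧_ (diagonal a p) (cong₂ _∧_ ab (cong₂ _∧_ ac refl)))
  (cong₂ _∧_ (cong₂ _∧_ ba (cong₂ _∧_ (diagonal b q) (cong₂ _∧_ bc refl)))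
  (cong₂ _∧_ (cong₂ _∧_ ca (cong₂ _∧_ cb (cong₂ _∧_ (diagonal c r) refl))) refl))
  where
  diagonal : ∀ x m → agree x x m m ≡ true
  diagonal x m = agree-≡ {x} {x} {m} {m} refl refl

orderIso-120 : ∀ a b c → orderIso (a ∷ b ∷ c ∷ []) (1 ∷ 2 ∷ 0 ∷ []) ≡ (a <ᵇ b) ∧ (c <ᵇ a)
orderIso-120 a b c = Bool-ext sound complete
  where
  sound : orderIso (a ∷ b ∷ c ∷ []) (1 ∷ 2 ∷ 0 ∷ []) ≡ true → (a <ᵇ b) ∧ (c <ᵇ a) ≡ true
  sound h with orderIso₃-sound {a} {b} {c} {1} {2} {0} h
  ... | ab , _ , _ , _ , ca , _ = cong₂ _∧_ (agree⇒<ᵇ≡ {a} {b} {1} {2} ab) (agree⇒<ᵇ≡ {c} {a} {0} {1} ca)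
  complete : (a <ᵇ b) ∧ (c <ᵇ a) ≡ true → orderIso (a ∷ b ∷ c ∷ []) (1 ∷ 2 ∷ 0 ∷ []) ≡ true
  complete h = orderIso₃-complete {a} {b} {c} {1} {2} {0} (agree-< {a} {b} {1} {2} a<b ≤-refl) (agree-> {a} {c} {1} {0} c<a z<s)
      (agree-> {b} {c} {2} {0} c<b z<s) (agree-> {b} {a} {2} {1} a<b ≤-refl) (agree-< {c} {a} {0} {1} c<a z<s)
      (agree-< {c} {b} {0} {2} c<b z<s)
    where
    a<b = <ᵇ≡true⇒< (∧-conicalˡ _ _ h)
    c<a = <ᵇ≡true⇒< (∧-conicalʳ _ _ h)
    c<b = <-trans c<a a<b

orderIso-101 : ∀ a b c → orderIso (a ∷ b ∷ c ∷ []) (1 ∷ 0 ∷ 1 ∷ []) ≡ (b <ᵇ a) ∧ (c ≡ᵇ a)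
orderIso-101 a b c = Bool-ext sound complete
  where
  sound : orderIso (a ∷ b ∷ c ∷ []) (1 ∷ 0 ∷ 1 ∷ []) ≡ true → (b <ᵇ a) ∧ (c ≡ᵇ a) ≡ true
  sound h with orderIso₃-sound {a} {b} {c} {1} {0} {1} h
  ... | _ , _ , _ , ba , ca , _ = cong₂ _∧_ (agree⇒<ᵇ≡ {b} {a} {0} {1} ba) (agree⇒≡ᵇ≡ {c} {a} {1} {1} ca)
  complete : (b <ᵇ a) ∧ (c ≡ᵇ a) ≡ true → orderIso (a ∷ b ∷ c ∷ []) (1 ∷ 0 ∷ 1 ∷ []) ≡ true
  complete h = orderIso₃-complete {a} {b} {c} {1} {0} {1} (agree-> {a} {b} {1} {0} b<a z<s) (agree-≡ {a} {c} {1} {1} (sym c≡a) refl)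
      (agree-< {b} {c} {0} {1} b<c z<s) (agree-< {b} {a} {0} {1} b<a z<s) (agree-≡ {c} {a} {1} {1} c≡a refl)
      (agree-> {c} {b} {1} {0} b<c z<s)
    where
    b<a = <ᵇ≡true⇒< (∧-conicalˡ _ _ h)
    c≡a = ≡ᵇ≡true⇒≡ (∧-conicalʳ _ _ h)
    b<c = subst (_ <_) (sym c≡a) b<a

lastOf : ℕ → List ℕ → ℕ
lastOf x []       = x
lastOf x (y ∷ ys) = lastOf y ys

lastOf-++-[] : ∀ x xs y → lastOf x (xs ++ [ y ]) ≡ y
lastOf-++-[] x []       y = refl
lastOf-++-[] x (z ∷ zs) y = lastOf-++-[] z zs y

catStep-++-[] : ∀ a xs y → catStep a (xs ++ [ y ]) ≡ catStep a xs ∧ (y ≤ᵇ suc (lastOf a xs))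
catStep-++-[] a []       y = ∧-identityʳ _
catStep-++-[] a (z ∷ zs) y = trans (cong (_∧_ (z ≤ᵇ suc a)) (catStep-++-[] z zs y)) (sym (∧-assoc (z ≤ᵇ suc a) _ _))

catStep-++⁻ : ∀ a xs ys → catStep a (xs ++ ys) ≡ true → catStep a xs ≡ true
catStep-++⁻ a []       ys h = refl
catStep-++⁻ a (z ∷ zs) ys h with ∧-split (z ≤ᵇ suc a) h
... | z≤sa , rest = cong₂ _∧_ z≤sa (catStep-++⁻ z zs ys rest)

any-++-[] : ∀ (f : ℕ → Bool) xs y → any f (xs ++ [ y ]) ≡ any f xs ∨ f y
any-++-[] f []       y = ∨-identityʳ (f y)
any-++-[] f (x ∷ xs) y = trans (cong (f x ∨_) (any-++-[] f xs y)) (sym (∨-assoc (f x) _ _))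

anyPair-++-[] : ∀ g xs y → anyPair g (xs ++ [ y ]) ≡ anyPair g xs ∨ any (λ z → g z y) xs
anyPair-++-[] g []       y = refl
anyPair-++-[] g (x ∷ xs) y = trans (cong₂ _∨_ (any-++-[] (g x) xs y) (anyPair-++-[] g xs y))
  (∨-interchange (any (g x) xs) (g x y) (anyPair g xs) _)

closesTriple : (ℕ → ℕ → ℕ → Bool) → List ℕ → ℕ → Bool
closesTriple t xs y = anyPair (λ a b → t a b y) xs

anyTriple-++-[] : ∀ t xs y → anyTriple t (xs ++ [ y ]) ≡ anyTriple t xs ∨ closesTriple t xs y
anyTriple-++-[] t []       y = refl
anyTriple-++-[] t (x ∷ xs) y = trans (cong₂ _∨_ (anyPair-++-[] (t x) xs y) (anyTriple-++-[] t xs y))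
  (∨-interchange (anyPair (t x) xs) _ (anyTriple t xs) _)

∨-true : ∀ {x y} → x ∨ y ≡ true → (x ≡ true) ⊎ (y ≡ true)
∨-true {true}  _ = inj₁ refl
∨-true {false} h = inj₂ h

∨-trueˡ : ∀ {x} y → x ≡ true → x ∨ y ≡ true
∨-trueˡ y refl = refl

∨-trueʳ : ∀ x {y} → y ≡ true → x ∨ y ≡ true
∨-trueʳ true  _ = refl
∨-trueʳ false h = h

any-++⁺ : ∀ (f : ℕ → Bool) xs ys → any f xs ≡ true → any f (xs ++ ys) ≡ true
any-++⁺ f (x ∷ xs) ys h with ∨-true {f x} h
... | inj₁ here  = ∨-trueˡ _ here
... | inj₂ there = ∨-trueʳ (f x) (any-++⁺ f xs ys there)

anyPair-++⁺ : ∀ g xs ys → anyPair g xs ≡ true → anyPair g (xs ++ ys) ≡ true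
anyPair-++⁺ g (x ∷ xs) ys h with ∨-true {any (g x) xs} h
... | inj₁ here  = ∨-trueˡ _ (any-++⁺ (g x) xs ys here)
... | inj₂ there = ∨-trueʳ (any (g x) (xs ++ ys)) (anyPair-++⁺ g xs ys there)

anyTriple-++⁺ : ∀ t xs ys → anyTriple t xs ≡ true → anyTriple t (xs ++ ys) ≡ true
anyTriple-++⁺ t (x ∷ xs) ys h with ∨-true {anyPair (t x) xs} h
... | inj₁ here  = ∨-trueˡ _ (anyPair-++⁺ (t x) xs ys here)
... | inj₂ there = ∨-trueʳ (anyPair (t x) (xs ++ ys)) (anyTriple-++⁺ t xs ys there)

catalanAvoiding : (ℕ → ℕ → ℕ → Bool) → List ℕ → Bool
catalanAvoiding t w = isCatalan w ∧ not (anyTriple t w)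

catalanAvoiding-++-[] : ∀ t r y → catalanAvoiding t (0 ∷ (r ++ [ y ])) ≡
  catalanAvoiding t (0 ∷ r) ∧ ((y ≤ᵇ suc (lastOf 0 r)) ∧ not (closesTriple t (0 ∷ r) y))
catalanAvoiding-++-[] t r y = begin
  catStep 0 (r ++ [ y ]) ∧ not (anyTriple t (0 ∷ (r ++ [ y ])))
    ≡⟨ cong₂ (λ u v → u ∧ not v) (catStep-++-[] 0 r y) (anyTriple-++-[] t (0 ∷ r) y) ⟩
  (catStep 0 r ∧ (y ≤ᵇ suc (lastOf 0 r))) ∧ not (anyTriple t (0 ∷ r) ∨ closesTriple t (0 ∷ r) y)
    ≡⟨ cong (_ ∧_) (deMorgan₂ (anyTriple t (0 ∷ r)) _) ⟩
  (catStep 0 r ∧ (y ≤ᵇ suc (lastOf 0 r))) ∧ (not (anyTriple t (0 ∷ r)) ∧ not (closesTriple t (0 ∷ r) y))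
    ≡⟨ ∧-interchange (catStep 0 r) _ _ _ ⟩
  catalanAvoiding t (0 ∷ r) ∧ ((y ≤ᵇ suc (lastOf 0 r)) ∧ not (closesTriple t (0 ∷ r) y)) ∎
  where open ≡-Reasoning

catalanAvoiding-++⁻ : ∀ t r w → catalanAvoiding t (0 ∷ (r ++ w)) ≡ true → catalanAvoiding t (0 ∷ r) ≡ true
catalanAvoiding-++⁻ t r w h with ∧-split (catStep 0 (r ++ w)) h | anyTriple t (0 ∷ r) in occurs
... | catalan , _     | false = cong₂ _∧_ (catStep-++⁻ 0 r w catalan) refl
... | _ , avoidsWhole | true  =
  contradiction (trans (sym (cong not (anyTriple-++⁺ t (0 ∷ r) w occurs))) avoidsWhole) λ ()

des-++-[] : ∀ x xs y → des (x ∷ (xs ++ [ y ])) ≡ des (x ∷ xs) + boolToℕ (y <ᵇ lastOf x xs)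
des-++-[] x []       y = +-identityʳ _
des-++-[] x (z ∷ zs) y = trans (cong (_+_ (boolToℕ (z <ᵇ x))) (des-++-[] z zs y)) (sym (+-assoc (boolToℕ (z <ᵇ x)) _ _))

catalanAvoiding-extend : ∀ t {r v y} → catalanAvoiding t (0 ∷ r) ≡ true → lastOf 0 r ≡ v →
                         (y ≤ᵇ suc v) ∧ not (closesTriple t (0 ∷ r) y) ≡ true →
                         catalanAvoiding t (0 ∷ (r ++ [ y ])) ≡ true
catalanAvoiding-extend t {r} {y = y} valid last≡ fits =
  trans (catalanAvoiding-++-[] t r y) (cong₂ _∧_ valid (subst (λ v → (y ≤ᵇ suc v) ∧ _ ≡ true) (sym last≡) fits))

-- A state summarises a valid prefix 0 ∷ r if it determines the last letter and exactly which
-- letters may follow; the completions of the prefix then depend on the state only.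
module Completions
  (t : ℕ → ℕ → ℕ → Bool) (State : Set) (Summarises : State → List ℕ → Set)
  (last : State → ℕ) (allowed : State → ℕ → Bool) (next : State → ℕ → State)
  (summary-valid : ∀ {s r} → Summarises s r → catalanAvoiding t (0 ∷ r) ≡ true)
  (summary-last : ∀ {s r} → Summarises s r → lastOf 0 r ≡ last s)
  (summary-allowed : ∀ {s r} y → Summarises s r →
                     (y ≤ᵇ suc (last s)) ∧ not (closesTriple t (0 ∷ r) y) ≡ allowed s y)
  (summary-next : ∀ {s r} y → Summarises s r → allowed s y ≡ true → Summarises (next s y) (r ++ [ y ]))
  (b : ℕ) where

  completions : State → ℕ → ℕ
  term : ℕ → State → ℕ → ℕ
  completions s zero    = 1
  completions s (suc m) = ∑< b (term m s)
  term m s y = if allowed s y then completions (next s y) m else 0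

  completionDescents : State → ℕ → ℕ
  descentTerm : ℕ → State → ℕ → ℕ
  completionDescents s zero    = 0
  completionDescents s (suc m) = ∑< b (descentTerm m s)
  descentTerm m s y =
    if allowed s y then boolToℕ (y <ᵇ last s) * completions (next s y) m + completionDescents (next s y) m else 0

  term-at : ∀ m s y {s′} → allowed s y ≡ true → next s y ≡ s′ → term m s y ≡ completions s′ m
  term-at m s y a n rewrite a | n = refl

  descentTerm-at : ∀ m s y {s′} c → allowed s y ≡ true → next s y ≡ s′ → (y <ᵇ last s) ≡ c →
                   descentTerm m s y ≡ boolToℕ c * completions s′ m + completionDescents s′ m
  descentTerm-at m s y c a n d rewrite a | n | d = refl

  valid : List ℕ → List ℕ → Bool
  valid r w = catalanAvoiding t (0 ∷ (r ++ w))

  ++-∷ : ∀ (r : List ℕ) y w → r ++ (y ∷ w) ≡ (r ++ [ y ]) ++ w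
  ++-∷ r y w = sym (++-assoc r [ y ] w)

  valid-++-[] : ∀ {s r} y → Summarises s r → catalanAvoiding t (0 ∷ (r ++ [ y ])) ≡ allowed s y
  valid-++-[] {s} {r} y σ = begin
    catalanAvoiding t (0 ∷ (r ++ [ y ]))
      ≡⟨ catalanAvoiding-++-[] t r y ⟩
    catalanAvoiding t (0 ∷ r) ∧ ((y ≤ᵇ suc (lastOf 0 r)) ∧ not (closesTriple t (0 ∷ r) y))
      ≡⟨ cong₂ (λ u v → u ∧ ((y ≤ᵇ suc v) ∧ not (closesTriple t (0 ∷ r) y))) (summary-valid σ) (summary-last σ) ⟩
    (y ≤ᵇ suc (last s)) ∧ not (closesTriple t (0 ∷ r) y)
      ≡⟨ summary-allowed y σ ⟩
    allowed s y ∎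
    where open ≡-Reasoning

  valid-forbidden : ∀ {s r} y → Summarises s r → allowed s y ≡ false → ∀ w → valid r (y ∷ w) ≡ false
  valid-forbidden {s} {r} y σ forbidden w with valid r (y ∷ w) in h
  ... | false = refl
  ... | true  = contradiction (trans (sym forbidden) (trans (sym (valid-++-[] y σ)) prefix)) λ ()
    where
    prefix : catalanAvoiding t (0 ∷ (r ++ [ y ])) ≡ true
    prefix = catalanAvoiding-++⁻ t (r ++ [ y ]) w (trans (cong (λ u → catalanAvoiding t (0 ∷ u)) (sym (++-∷ r y w))) h)

  completions-correct : ∀ m {s r} → Summarises s r →
                        ∑words b m (λ w → boolToℕ (valid r w)) ≡ completions s m
  completions-correct zero    {s} {r} σ rewrite ++-identityʳ r | summary-valid σ = refl
  completions-correct (suc m) {s} {r} σ = trans (∑words-suc b m _) (∑<-cong b (λ y _ → step y))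
    where
    step : ∀ y → ∑words b m (λ w → boolToℕ (valid r (y ∷ w))) ≡ term m s y
    step y with allowed s y in a
    ... | true  = trans (∑words-cong b m (λ w → cong (λ u → boolToℕ (catalanAvoiding t (0 ∷ u))) (++-∷ r y w)))
                        (completions-correct m (summary-next y σ a))
    ... | false = ∑words-zero b m (λ w → cong boolToℕ (valid-forbidden y σ a w))

  weighted : List ℕ → List ℕ → ℕ
  weighted r w = if valid r w then des (0 ∷ (r ++ w)) else 0

  completionDescents-correct : ∀ m {s r} → Summarises s r →
    ∑words b m (weighted r) ≡ des (0 ∷ r) * completions s m + completionDescents s m
  completionDescents-correct zero {s} {r} σ rewrite ++-identityʳ r | summary-valid σ =
    trans (+-identityʳ _) (trans (sym (*-identityʳ _)) (sym (+-identityʳ _)))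
  completionDescents-correct (suc m) {s} {r} σ = begin
    ∑words b (suc m) (weighted r)
      ≡⟨ ∑words-suc b m _ ⟩
    ∑[ y < b ] ∑words b m (λ w → weighted r (y ∷ w))
      ≡⟨ ∑<-cong b (λ y _ → step y) ⟩
    ∑[ y < b ] (des (0 ∷ r) * term m s y + descentTerm m s y)
      ≡⟨ ∑<-distrib-+ b (λ y → des (0 ∷ r) * term m s y) (descentTerm m s) ⟩
    ∑[ y < b ] (des (0 ∷ r) * term m s y) + completionDescents s (suc m)
      ≡⟨ cong (_+ completionDescents s (suc m)) (∑<-distribˡ-* b (des (0 ∷ r)) (term m s)) ⟩
    des (0 ∷ r) * completions s (suc m) + completionDescents s (suc m) ∎
    where
    open ≡-Reasoning
    distrib : ∀ d i n e → (d + i) * n + e ≡ d * n + (i * n + e)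
    distrib = solve-∀
    step : ∀ y → ∑words b m (λ w → weighted r (y ∷ w)) ≡ des (0 ∷ r) * term m s y + descentTerm m s y
    step y with allowed s y in a
    ... | true  = begin
      ∑words b m (λ w → weighted r (y ∷ w))
        ≡⟨ ∑words-cong b m (λ w → cong (λ u → if catalanAvoiding t (0 ∷ u) then des (0 ∷ u) else 0) (++-∷ r y w)) ⟩
      ∑words b m (weighted (r ++ [ y ]))
        ≡⟨ completionDescents-correct m (summary-next y σ a) ⟩
      des (0 ∷ (r ++ [ y ])) * completions (next s y) m + completionDescents (next s y) m
        ≡⟨ cong (λ d → d * completions (next s y) m + completionDescents (next s y) m)
                (trans (des-++-[] 0 r y) (cong (λ v → des (0 ∷ r) + boolToℕ (y <ᵇ v)) (summary-last σ))) ⟩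
      (des (0 ∷ r) + boolToℕ (y <ᵇ last s)) * completions (next s y) m + completionDescents (next s y) m
        ≡⟨ distrib (des (0 ∷ r)) _ _ _ ⟩
      des (0 ∷ r) * completions (next s y) m
        + (boolToℕ (y <ᵇ last s) * completions (next s y) m + completionDescents (next s y) m) ∎
    ... | false = trans (∑words-zero b m (λ w → cong (λ c → if c then des (0 ∷ (r ++ y ∷ w)) else 0) (valid-forbidden y σ a w)))
                        (sym (trans (+-identityʳ _) (*-zeroʳ (des (0 ∷ r)))))

module CatalanAvoiders (p : List ℕ) (t : ℕ → ℕ → ℕ → Bool) (contains≡ : ∀ w → contains w p ≡ anyTriple t w) where

  avoids : List ℕ → Bool
  avoids w = isCatalan w ∧ not (contains w p)

  avoids-0∷ : ∀ w → avoids (0 ∷ w) ≡ catalanAvoiding t (0 ∷ w)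
  avoids-0∷ w = cong (λ c → catStep 0 w ∧ not c) (contains≡ (0 ∷ w))

  length-Cat : ∀ m → length (Cat (suc m) p) ≡ ∑words (suc m) m (λ w → boolToℕ (catalanAvoiding t (0 ∷ w)))
  length-Cat m = begin
    length (Cat (suc m) p)
      ≡⟨ length-filterᵇ avoids (wordsOver (suc m) (suc m)) ⟩
    ∑words (suc m) (suc m) (boolToℕ ∘ avoids)
      ≡⟨ ∑words-suc (suc m) m _ ⟩
    ∑words (suc m) m (λ w → boolToℕ (avoids (0 ∷ w))) + ∑[ k < m ] ∑words (suc m) m (λ w → boolToℕ (avoids (suc k ∷ w)))
      ≡⟨ cong₂ _+_ (∑words-cong (suc m) m (cong boolToℕ ∘ avoids-0∷))
                   (∑<-zero m (λ k _ → ∑words-zero (suc m) m (λ _ → refl))) ⟩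
    ∑words (suc m) m (λ w → boolToℕ (catalanAvoiding t (0 ∷ w))) + 0
      ≡⟨ +-identityʳ _ ⟩
    ∑words (suc m) m (λ w → boolToℕ (catalanAvoiding t (0 ∷ w))) ∎
    where open ≡-Reasoning

  descents-Cat : ∀ m → sum (map des (Cat (suc m) p)) ≡
                       ∑words (suc m) m (λ w → if catalanAvoiding t (0 ∷ w) then des (0 ∷ w) else 0)
  descents-Cat m = begin
    sum (map des (Cat (suc m) p))
      ≡⟨ sum-map-filterᵇ des avoids (wordsOver (suc m) (suc m)) ⟩
    ∑words (suc m) (suc m) (λ w → if avoids w then des w else 0)
      ≡⟨ ∑words-suc (suc m) m _ ⟩
    ∑words (suc m) m (λ w → if avoids (0 ∷ w) then des (0 ∷ w) else 0)
      + ∑[ k < m ] ∑words (suc m) m (λ w → if avoids (suc k ∷ w) then des (suc k ∷ w) else 0)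
      ≡⟨ cong₂ _+_ (∑words-cong (suc m) m (λ w → cong (λ c → if c then des (0 ∷ w) else 0) (avoids-0∷ w)))
                   (∑<-zero m (λ k _ → ∑words-zero (suc m) m (λ _ → refl))) ⟩
    ∑words (suc m) m (λ w → if catalanAvoiding t (0 ∷ w) then des (0 ∷ w) else 0) + 0
      ≡⟨ +-identityʳ _ ⟩
    ∑words (suc m) m (λ w → if catalanAvoiding t (0 ∷ w) then des (0 ∷ w) else 0) ∎
    where open ≡-Reasoning

countA countB descA descB : ℕ → ℕ
countA zero    = 1
countA (suc m) = countA m + countB m
countB zero    = 1
countB (suc m) = countA m + countB m + countB m
descA zero    = 0
descA (suc m) = descA m + descB m
descB zero    = 0
descB (suc m) = descA m + descB m + descB m + countA m

is120 : ℕ → ℕ → ℕ → Bool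
is120 a b c = (a <ᵇ b) ∧ (c <ᵇ a)

ascentFloor : List ℕ → ℕ
ascentFloor []       = 0
ascentFloor (x ∷ xs) = (if any (x <ᵇ_) xs then x else 0) ⊔ ascentFloor xs

maxBelow : List ℕ → ℕ → ℕ
maxBelow []       y = 0
maxBelow (x ∷ xs) y = (if x <ᵇ y then x else 0) ⊔ maxBelow xs y

any-∧ʳ : ∀ (f : ℕ → Bool) c xs → any (λ z → f z ∧ c) xs ≡ any f xs ∧ c
any-∧ʳ f c []       = refl
any-∧ʳ f c (z ∷ zs) = trans (cong ((f z ∧ c) ∨_) (any-∧ʳ f c zs)) (sym (∧-distribʳ-∨ c (f z) _))

<ᵇ-if : ∀ y c x → (y <ᵇ (if c then x else 0)) ≡ c ∧ (y <ᵇ x)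
<ᵇ-if y true  x = refl
<ᵇ-if y false x = refl

<ᵇ-⊔ : ∀ y m n → (y <ᵇ (m ⊔ n)) ≡ (y <ᵇ m) ∨ (y <ᵇ n)
<ᵇ-⊔ y m n with ≤-total m n
... | inj₁ m≤n rewrite m≤n⇒m⊔n≡n m≤n with y <ᵇ m in y<m
...   | true  = <⇒<ᵇ≡true (<-≤-trans (<ᵇ≡true⇒< y<m) m≤n)
...   | false = refl
<ᵇ-⊔ y m n | inj₂ n≤m rewrite m≥n⇒m⊔n≡m n≤m with y <ᵇ n in y<n
...   | true  = trans (<⇒<ᵇ≡true (<-≤-trans (<ᵇ≡true⇒< y<n) n≤m)) (sym (∨-trueʳ (y <ᵇ m) refl))
...   | false = sym (∨-identityʳ _)

if-∨-⊔ : ∀ a c x → (if a ∨ c then x else 0) ≡ (if a then x else 0) ⊔ (if c then x else 0)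
if-∨-⊔ true  true  x = sym (⊔-idem x)
if-∨-⊔ true  false x = sym (⊔-identityʳ x)
if-∨-⊔ false c     x = refl

closes-120 : ∀ u y → closesTriple is120 u y ≡ (y <ᵇ ascentFloor u)
closes-120 []       y = refl
closes-120 (x ∷ xs) y = begin
  any (λ z → (x <ᵇ z) ∧ (y <ᵇ x)) xs ∨ closesTriple is120 xs y
    ≡⟨ cong₂ _∨_ (any-∧ʳ (x <ᵇ_) (y <ᵇ x) xs) (closes-120 xs y) ⟩
  (any (x <ᵇ_) xs ∧ (y <ᵇ x)) ∨ (y <ᵇ ascentFloor xs)
    ≡⟨ cong (_∨ (y <ᵇ ascentFloor xs)) (sym (<ᵇ-if y (any (x <ᵇ_) xs) x)) ⟩
  (y <ᵇ (if any (x <ᵇ_) xs then x else 0)) ∨ (y <ᵇ ascentFloor xs)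
    ≡⟨ sym (<ᵇ-⊔ y (if any (x <ᵇ_) xs then x else 0) (ascentFloor xs)) ⟩
  y <ᵇ ascentFloor (x ∷ xs) ∎
  where open ≡-Reasoning

ascentFloor-++-[] : ∀ xs y → ascentFloor (xs ++ [ y ]) ≡ ascentFloor xs ⊔ maxBelow xs y
ascentFloor-++-[] []       y = refl
ascentFloor-++-[] (x ∷ xs) y = begin
  (if any (x <ᵇ_) (xs ++ [ y ]) then x else 0) ⊔ ascentFloor (xs ++ [ y ])
    ≡⟨ cong₂ _⊔_ (trans (cong (λ c → if c then x else 0) (any-++-[] (x <ᵇ_) xs y)) (if-∨-⊔ (any (x <ᵇ_) xs) (x <ᵇ y) x))
                 (ascentFloor-++-[] xs y) ⟩
  ((if any (x <ᵇ_) xs then x else 0) ⊔ (if x <ᵇ y then x else 0)) ⊔ (ascentFloor xs ⊔ maxBelow xs y)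
    ≡⟨ ⊔-interchange (if any (x <ᵇ_) xs then x else 0) _ _ _ ⟩
  ascentFloor (x ∷ xs) ⊔ maxBelow (x ∷ xs) y ∎
  where open ≡-Reasoning

any-lastOf : ∀ f z zs → f (lastOf z zs) ≡ true → any f (z ∷ zs) ≡ true
any-lastOf f z []       h = ∨-trueˡ _ h
any-lastOf f z (w ∷ ws) h = ∨-trueʳ (f z) (any-lastOf f w ws h)

maxBelow-≤-ascentFloor : ∀ x xs y → y ≤ lastOf x xs → maxBelow (x ∷ xs) y ≤ ascentFloor (x ∷ xs)
maxBelow-≤-ascentFloor x []       y y≤x rewrite ≥⇒<ᵇ≡false {x} {y} y≤x = z≤n
maxBelow-≤-ascentFloor x (z ∷ zs) y y≤last with x <ᵇ y in x<y
... | true  = ⊔-lub (≤-trans (≤-reflexive (cong (λ c → if c then x else 0) (sym ascends))) (m≤m⊔n floorHead _))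
                    (≤-trans (maxBelow-≤-ascentFloor z zs y y≤last) (m≤n⊔m floorHead _))
  where
  floorHead = if any (x <ᵇ_) (z ∷ zs) then x else 0
  ascends : any (x <ᵇ_) (z ∷ zs) ≡ true
  ascends = any-lastOf (x <ᵇ_) z zs (<⇒<ᵇ≡true (<-≤-trans (<ᵇ≡true⇒< x<y) y≤last))
... | false = ≤-trans (maxBelow-≤-ascentFloor z zs y y≤last) (m≤n⊔m (if any (x <ᵇ_) (z ∷ zs) then x else 0) _)

maxBelow-suc-lastOf : ∀ x xs → maxBelow (x ∷ xs) (suc (lastOf x xs)) ≡ lastOf x xs
maxBelow-suc-lastOf x []       rewrite <⇒<ᵇ≡true {x} {suc x} ≤-refl = ⊔-identityʳ x
maxBelow-suc-lastOf x (z ∷ zs) rewrite maxBelow-suc-lastOf z zs = m≤n⇒m⊔n≡n (bounded (x <ᵇ suc (lastOf z zs)) refl)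
  where
  bounded : ∀ c → c ≡ (x <ᵇ suc (lastOf z zs)) → (if c then x else 0) ≤ lastOf z zs
  bounded true  h = ≤-pred (<ᵇ≡true⇒< (sym h))
  bounded false h = z≤n

record Summary120 (v f : ℕ) (r : List ℕ) : Set where
  field
    valid        : catalanAvoiding is120 (0 ∷ r) ≡ true
    last≡        : lastOf 0 r ≡ v
    floor≡       : ascentFloor (0 ∷ r) ≡ f
    floor≤last   : f ≤ v
    last≤1+floor : v ≤ suc f

Summarises120 : ℕ × ℕ → List ℕ → Set
Summarises120 (v , f) = Summary120 v f

allowed120 : ℕ × ℕ → ℕ → Bool
allowed120 (v , f) y = (y ≤ᵇ suc v) ∧ not (y <ᵇ f)

next120 : ℕ × ℕ → ℕ → ℕ × ℕ
next120 (v , f) y = y , (if y ≡ᵇ suc v then v else f)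

allowed120-inside : ∀ {v f y} → f ≤ y → y ≤ suc v → allowed120 (v , f) y ≡ true
allowed120-inside f≤y y≤sv rewrite ≤⇒≤ᵇ≡true y≤sv | ≥⇒<ᵇ≡false f≤y = refl

allowed120-below : ∀ {v f y} → y < f → allowed120 (v , f) y ≡ false
allowed120-below y<f rewrite <⇒<ᵇ≡true y<f = ∧-zeroʳ _

allowed120-above : ∀ {v f y} → suc v < y → allowed120 (v , f) y ≡ false
allowed120-above sv<y rewrite >⇒≤ᵇ≡false sv<y = refl

next120-up : ∀ v f → next120 (v , f) (suc v) ≡ (suc v , v)
next120-up v f rewrite ≡⇒≡ᵇ≡true {v} refl = refl

next120-stay : ∀ {v f y} → y ≤ v → next120 (v , f) y ≡ (y , f)
next120-stay y≤v rewrite ≢⇒≡ᵇ≡false (<⇒≢ (s≤s y≤v)) = refl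

summary120-allowed : ∀ {s r} y → Summarises120 s r →
                     (y ≤ᵇ suc (proj₁ s)) ∧ not (closesTriple is120 (0 ∷ r) y) ≡ allowed120 s y
summary120-allowed {r = r} y σ rewrite closes-120 (0 ∷ r) y | Summary120.floor≡ σ = refl

summary120-up : ∀ {v f r} → Summary120 v f r → Summary120 (suc v) v (r ++ [ suc v ])
summary120-up {v} {f} {r} σ = record
  { valid        = catalanAvoiding-extend is120 {r} {v} {suc v} valid last≡
                     (trans (summary120-allowed (suc v) σ) (allowed120-inside (≤-trans floor≤last (n≤1+n v)) ≤-refl))
  ; last≡        = lastOf-++-[] 0 r (suc v)
  ; floor≡       = begin
      ascentFloor (0 ∷ (r ++ [ suc v ]))             ≡⟨ ascentFloor-++-[] (0 ∷ r) (suc v) ⟩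
      ascentFloor (0 ∷ r) ⊔ maxBelow (0 ∷ r) (suc v)
        ≡⟨ cong₂ (λ f′ v′ → f′ ⊔ maxBelow (0 ∷ r) (suc v′)) floor≡ (sym last≡) ⟩
      f ⊔ maxBelow (0 ∷ r) (suc (lastOf 0 r))        ≡⟨ cong (f ⊔_) (trans (maxBelow-suc-lastOf 0 r) last≡) ⟩
      f ⊔ v                                          ≡⟨ m≤n⇒m⊔n≡n floor≤last ⟩
      v                                              ∎
  ; floor≤last   = n≤1+n v
  ; last≤1+floor = ≤-refl
  }
  where
  open Summary120 σ
  open ≡-Reasoning

summary120-stay : ∀ {v f r y} → Summary120 v f r → f ≤ y → y ≤ v → Summary120 y f (r ++ [ y ])
summary120-stay {v} {f} {r} {y} σ f≤y y≤v = record
  { valid        = catalanAvoiding-extend is120 {r} {v} {y} valid last≡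
                     (trans (summary120-allowed y σ) (allowed120-inside f≤y (≤-trans y≤v (n≤1+n v))))
  ; last≡        = lastOf-++-[] 0 r y
  ; floor≡       = trans (ascentFloor-++-[] (0 ∷ r) y) (trans (cong (_⊔ maxBelow (0 ∷ r) y) floor≡)
                         (m≥n⇒m⊔n≡m (≤-trans (maxBelow-≤-ascentFloor 0 r y (subst (y ≤_) (sym last≡) y≤v))
                                             (≤-reflexive floor≡))))
  ; floor≤last   = f≤y
  ; last≤1+floor = ≤-trans y≤v last≤1+floor
  }
  where open Summary120 σ

summary120-next : ∀ {s r} y → Summarises120 s r → allowed120 s y ≡ true → Summarises120 (next120 s y) (r ++ [ y ])
summary120-next {v , f} {r} y σ allowed with y ≡ᵇ suc v in y≡sv
... | true  = subst (λ z → Summary120 z v (r ++ [ z ])) (sym (≡ᵇ≡true⇒≡ y≡sv)) (summary120-up σ)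
... | false = summary120-stay σ (<ᵇ≡false⇒≥ (not-injective (∧-conicalʳ _ _ allowed))) y≤v
  where
  y≤v : y ≤ v
  y≤v = ≤-pred (≤∧≢⇒< (≤ᵇ≡true⇒≤ (∧-conicalˡ _ _ allowed)) y≢sv)
    where
    y≢sv : y ≢ suc v
    y≢sv y≡ = contradiction (trans (sym y≡sv) (≡⇒≡ᵇ≡true y≡)) λ ()

module Completions120 = Completions is120 (ℕ × ℕ) Summarises120 proj₁ allowed120 next120
  Summary120.valid Summary120.last≡ summary120-allowed summary120-next

-- Cat n only enumerates words over {0, …, n - 1}; the bound v + m < b guarantees that this
-- alphabet never cuts off a completion, whose letters stay below v + m + 1.
module Evaluate120 (b : ℕ) where
  open Completions120 b

  ∑<-level : ∀ {m v} (g : ℕ → ℕ) → v + suc m < b → (∀ y → allowed120 (v , v) y ≡ false → g y ≡ 0) →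
             ∑< b g ≡ g v + (g (suc v) + 0)
  ∑<-level {v = v} g lt off = ∑<-interval v 2 g (2+≤ v lt)
    (λ _ y<v → off _ (allowed120-below {v} {v} y<v)) (λ _ h → off _ (allowed120-above {v} {v} h))

  ∑<-raised : ∀ {m f} (g : ℕ → ℕ) → suc f + suc m < b → (∀ y → allowed120 (suc f , f) y ≡ false → g y ≡ 0) →
              ∑< b g ≡ g f + (g (suc f) + (g (suc (suc f)) + 0))
  ∑<-raised {f = f} g lt off = ∑<-interval f 3 g (2+≤ (suc f) lt)
    (λ _ y<f → off _ (allowed120-below {suc f} {f} y<f)) (λ _ h → off _ (allowed120-above {suc f} {f} h))

  f≤2+f : ∀ f → f ≤ suc (suc f)
  f≤2+f f = ≤-trans (n≤1+n f) (n≤1+n (suc f))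

  mutual
    completions-level : ∀ m v → v + m < b → completions (v , v) m ≡ countA m
    completions-level zero    v _  = refl
    completions-level (suc m) v lt = begin
      ∑< b (term m (v , v))
        ≡⟨ ∑<-level (term m (v , v)) lt (λ _ → if-false) ⟩
      term m (v , v) v + (term m (v , v) (suc v) + 0)
        ≡⟨ cong₂ (λ x y → x + (y + 0))
             (term-at m (v , v) v (allowed120-inside ≤-refl (n≤1+n v)) (next120-stay ≤-refl))
             (term-at m (v , v) (suc v) (allowed120-inside (n≤1+n v) ≤-refl) (next120-up v v)) ⟩
      completions (v , v) m + (completions (suc v , v) m + 0)
        ≡⟨ cong₂ (λ x y → x + (y + 0)) (completions-level m v (drop-< v (shift-< v lt))) (completions-raised m v (shift-< v lt)) ⟩
      countA m + (countB m + 0)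
        ≡⟨ cong (_+_ (countA m)) (+-identityʳ _) ⟩
      countA (suc m) ∎
      where open ≡-Reasoning

    completions-raised : ∀ m f → suc f + m < b → completions (suc f , f) m ≡ countB m
    completions-raised zero    f _  = refl
    completions-raised (suc m) f lt = begin
      ∑< b (term m (suc f , f))
        ≡⟨ ∑<-raised (term m (suc f , f)) lt (λ _ → if-false) ⟩
      term m (suc f , f) f + (term m (suc f , f) (suc f) + (term m (suc f , f) (suc (suc f)) + 0))
        ≡⟨ cong₂ _+_ (term-at m (suc f , f) f (allowed120-inside ≤-refl (f≤2+f f)) (next120-stay (n≤1+n f)))
             (cong₂ (λ x y → x + (y + 0))
               (term-at m (suc f , f) (suc f) (allowed120-inside (n≤1+n f) (n≤1+n (suc f))) (next120-stay ≤-refl))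
               (term-at m (suc f , f) (suc (suc f)) (allowed120-inside (f≤2+f f) ≤-refl) (next120-up (suc f) f))) ⟩
      completions (f , f) m + (completions (suc f , f) m + (completions (suc (suc f) , suc f) m + 0))
        ≡⟨ cong₂ _+_ (completions-level m f (drop-< f (drop-< (suc f) (shift-< (suc f) lt))))
             (cong₂ (λ x y → x + (y + 0)) (completions-raised m f (drop-< (suc f) (shift-< (suc f) lt)))
                                          (completions-raised m (suc f) (shift-< (suc f) lt))) ⟩
      countA m + (countB m + (countB m + 0))
        ≡⟨ regroup (countA m) (countB m) ⟩
      countB (suc m) ∎
      where
      open ≡-Reasoning
      regroup : ∀ a c → a + (c + (c + 0)) ≡ a + c + c
      regroup = solve-∀

  mutual
    descents-level : ∀ m v → v + m < b → completionDescents (v , v) m ≡ descA m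
    descents-level zero    v _  = refl
    descents-level (suc m) v lt = begin
      ∑< b (descentTerm m (v , v))
        ≡⟨ ∑<-level (descentTerm m (v , v)) lt (λ _ → if-false) ⟩
      descentTerm m (v , v) v + (descentTerm m (v , v) (suc v) + 0)
        ≡⟨ cong₂ (λ x y → x + (y + 0))
             (descentTerm-at m (v , v) v false (allowed120-inside ≤-refl (n≤1+n v)) (next120-stay ≤-refl) (<ᵇ-irrefl v))
             (descentTerm-at m (v , v) (suc v) false (allowed120-inside (n≤1+n v) ≤-refl) (next120-up v v) (≥⇒<ᵇ≡false (n≤1+n v))) ⟩
      completionDescents (v , v) m + (completionDescents (suc v , v) m + 0)
        ≡⟨ cong₂ (λ x y → x + (y + 0)) (descents-level m v (drop-< v (shift-< v lt))) (descents-raised m v (shift-< v lt)) ⟩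
      descA m + (descB m + 0)
        ≡⟨ cong (_+_ (descA m)) (+-identityʳ _) ⟩
      descA (suc m) ∎
      where open ≡-Reasoning

    descents-raised : ∀ m f → suc f + m < b → completionDescents (suc f , f) m ≡ descB m
    descents-raised zero    f _  = refl
    descents-raised (suc m) f lt = begin
      ∑< b (descentTerm m (suc f , f))
        ≡⟨ ∑<-raised (descentTerm m (suc f , f)) lt (λ _ → if-false) ⟩
      descentTerm m (suc f , f) f + (descentTerm m (suc f , f) (suc f) + (descentTerm m (suc f , f) (suc (suc f)) + 0))
        ≡⟨ cong₂ _+_
             (descentTerm-at m (suc f , f) f true (allowed120-inside ≤-refl (f≤2+f f))
                             (next120-stay (n≤1+n f)) (<⇒<ᵇ≡true (n<1+n f)))
             (cong₂ (λ x y → x + (y + 0))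
               (descentTerm-at m (suc f , f) (suc f) false (allowed120-inside (n≤1+n f) (n≤1+n (suc f)))
                               (next120-stay ≤-refl) (<ᵇ-irrefl (suc f)))
               (descentTerm-at m (suc f , f) (suc (suc f)) false (allowed120-inside (f≤2+f f) ≤-refl)
                               (next120-up (suc f) f) (≥⇒<ᵇ≡false (n≤1+n (suc f))))) ⟩
      (1 * completions (f , f) m + completionDescents (f , f) m)
        + (completionDescents (suc f , f) m + (completionDescents (suc (suc f) , suc f) m + 0))
        ≡⟨ cong₂ _+_ (cong₂ (λ x y → 1 * x + y) (completions-level m f below) (descents-level m f below))
             (cong₂ (λ x y → x + (y + 0)) (descents-raised m f (drop-< (suc f) (shift-< (suc f) lt)))
                                          (descents-raised m (suc f) (shift-< (suc f) lt))) ⟩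
      (1 * countA m + descA m) + (descB m + (descB m + 0))
        ≡⟨ regroup (countA m) (descA m) (descB m) ⟩
      descB (suc m) ∎
      where
      open ≡-Reasoning
      regroup : ∀ a c e → (1 * a + c) + (e + (e + 0)) ≡ c + e + e + a
      regroup = solve-∀
      below = drop-< f (drop-< (suc f) (shift-< (suc f) lt))

summary120-initial : Summary120 0 0 []
summary120-initial = record { valid = refl ; last≡ = refl ; floor≡ = refl ; floor≤last = z≤n ; last≤1+floor = z≤n }

module Avoiders120 = CatalanAvoiders (1 ∷ 2 ∷ 0 ∷ []) is120 (contains-triple is120 orderIso-120)

length-Cat-120 : ∀ m → length (Cat (suc m) (1 ∷ 2 ∷ 0 ∷ [])) ≡ countA m
length-Cat-120 m = trans (Avoiders120.length-Cat m)
  (trans (Completions120.completions-correct (suc m) m summary120-initial)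
         (Evaluate120.completions-level (suc m) m 0 ≤-refl))

descents-Cat-120 : ∀ m → sum (map des (Cat (suc m) (1 ∷ 2 ∷ 0 ∷ []))) ≡ descA m
descents-Cat-120 m = trans (Avoiders120.descents-Cat m)
  (trans (Completions120.completionDescents-correct (suc m) m summary120-initial)
         (Evaluate120.descents-level (suc m) m 0 ≤-refl))

is101 : ℕ → ℕ → ℕ → Bool
is101 a b c = (b <ᵇ a) ∧ (c ≡ᵇ a)

any-cong : ∀ {f g : ℕ → Bool} → (∀ x → f x ≡ g x) → ∀ xs → any f xs ≡ any g xs
any-cong eq []       = refl
any-cong eq (x ∷ xs) = cong₂ _∨_ (eq x) (any-cong eq xs)

any-∧ˡ : ∀ c (f : ℕ → Bool) xs → any (λ x → c ∧ f x) xs ≡ c ∧ any f xs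
any-∧ˡ true  f xs = refl
any-∧ˡ false f []       = refl
any-∧ˡ false f (x ∷ xs) = any-∧ˡ false f xs

closes-101-++-[] : ∀ u y z → closesTriple is101 (u ++ [ y ]) z ≡ closesTriple is101 u z ∨ ((y <ᵇ z) ∧ any (z ≡ᵇ_) u)
closes-101-++-[] u y z = trans (anyPair-++-[] (λ a b → is101 a b z) u y)
  (cong (closesTriple is101 u z ∨_) (trans (any-cong pointwise u) (any-∧ˡ (y <ᵇ z) (z ≡ᵇ_) u)))
  where
  pointwise : ∀ x → is101 x y z ≡ (y <ᵇ z) ∧ (z ≡ᵇ x)
  pointwise x with z ≡ᵇ x in z≡x
  ... | true  = cong (λ a → (y <ᵇ a) ∧ true) (sym (≡ᵇ≡true⇒≡ {z} {x} z≡x))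
  ... | false = trans (∧-zeroʳ _) (sym (∧-zeroʳ _))

occurs-++-[]ˡ : ∀ u y z → any (z ≡ᵇ_) u ≡ true → any (z ≡ᵇ_) (u ++ [ y ]) ≡ true
occurs-++-[]ˡ u y z = any-++⁺ (z ≡ᵇ_) u [ y ]

occurs-++-[]ʳ : ∀ u y → any (y ≡ᵇ_) (u ++ [ y ]) ≡ true
occurs-++-[]ʳ u y = trans (any-++-[] (y ≡ᵇ_) u y) (∨-trueʳ _ (≡⇒≡ᵇ≡true {y} refl))

occurs-≤ : ∀ {z v} u → any (z ≡ᵇ_) u ≡ true → any (v <ᵇ_) u ≡ false → z ≤ v
occurs-≤ {z} {v} (x ∷ xs) occurs bounded with z ≡ᵇ x in z≡x | v <ᵇ x in v<x
... | true  | false = subst (_≤ v) (sym (≡ᵇ≡true⇒≡ z≡x)) (<ᵇ≡false⇒≥ v<x)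
... | false | false = occurs-≤ xs occurs bounded

bounded-mono : ∀ {v y} u → v ≤ y → any (v <ᵇ_) u ≡ false → any (y <ᵇ_) u ≡ false
bounded-mono []       v≤y _ = refl
bounded-mono {v} {y} (x ∷ xs) v≤y bounded with v <ᵇ x in v<x
... | false = cong₂ _∨_ (≥⇒<ᵇ≡false {y} {x} (≤-trans (<ᵇ≡false⇒≥ v<x) v≤y)) (bounded-mono xs v≤y bounded)

-- Before the first strict descent the prefix is weakly increasing and no letter completes a
-- 101; after a descent to v, the letter v + 1 would complete one.
data State101 : Set where
  ascending descended : ℕ → State101

last101 : State101 → ℕ
last101 (ascending v) = v
last101 (descended v) = v

allowed101 : State101 → ℕ → Bool
allowed101 (ascending v) y = y ≤ᵇ suc v
allowed101 (descended v) y = y ≤ᵇ v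

next101 : State101 → ℕ → State101
next101 (ascending v) y = if y <ᵇ v then descended y else ascending y
next101 (descended v) y = descended y

record Ascending101 (v : ℕ) (r : List ℕ) : Set where
  field
    valid      : catalanAvoiding is101 (0 ∷ r) ≡ true
    last≡      : lastOf 0 r ≡ v
    closesNone : ∀ z → closesTriple is101 (0 ∷ r) z ≡ false
    covers     : ∀ z → z ≤ v → any (z ≡ᵇ_) (0 ∷ r) ≡ true
    bounded    : any (v <ᵇ_) (0 ∷ r) ≡ false

record Descended101 (v : ℕ) (r : List ℕ) : Set where
  field
    valid        : catalanAvoiding is101 (0 ∷ r) ≡ true
    last≡        : lastOf 0 r ≡ v
    covers       : ∀ z → z ≤ suc v → any (z ≡ᵇ_) (0 ∷ r) ≡ true
    closesBelow  : ∀ z → z ≤ v → closesTriple is101 (0 ∷ r) z ≡ false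
    closesAbove  : closesTriple is101 (0 ∷ r) (suc v) ≡ true

Summarises101 : State101 → List ℕ → Set
Summarises101 (ascending v) = Ascending101 v
Summarises101 (descended v) = Descended101 v

summary101-valid : ∀ {s r} → Summarises101 s r → catalanAvoiding is101 (0 ∷ r) ≡ true
summary101-valid {ascending v} = Ascending101.valid
summary101-valid {descended v} = Descended101.valid

summary101-last : ∀ {s r} → Summarises101 s r → lastOf 0 r ≡ last101 s
summary101-last {ascending v} = Ascending101.last≡
summary101-last {descended v} = Descended101.last≡

summary101-allowed : ∀ {s r} y → Summarises101 s r →
                     (y ≤ᵇ suc (last101 s)) ∧ not (closesTriple is101 (0 ∷ r) y) ≡ allowed101 s y
summary101-allowed {ascending v} y σ rewrite Ascending101.closesNone σ y = ∧-identityʳ _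
summary101-allowed {descended v} y σ with <-cmp y (suc v)
... | tri< y<sv _ _ rewrite Descended101.closesBelow σ y (≤-pred y<sv)
                          | ≤⇒≤ᵇ≡true (<⇒≤ y<sv) | ≤⇒≤ᵇ≡true (≤-pred y<sv) = refl
... | tri≈ _ refl _ rewrite Descended101.closesAbove σ | >⇒≤ᵇ≡false {suc v} {v} ≤-refl = ∧-zeroʳ _
... | tri> _ _ sv<y rewrite >⇒≤ᵇ≡false sv<y | >⇒≤ᵇ≡false (<-trans (n<1+n v) sv<y) = refl

summary101-extend : ∀ {s r} y → Summarises101 s r → allowed101 s y ≡ true → catalanAvoiding is101 (0 ∷ (r ++ [ y ])) ≡ true
summary101-extend {s} {r} y σ allowed =
  catalanAvoiding-extend is101 {r} {last101 s} {y} (summary101-valid σ) (summary101-last σ) (trans (summary101-allowed y σ) allowed)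

summary101-descend : ∀ {r y} → catalanAvoiding is101 (0 ∷ (r ++ [ y ])) ≡ true →
                     (∀ z → z ≤ suc y → any (z ≡ᵇ_) (0 ∷ r) ≡ true) →
                     (∀ z → z ≤ y → closesTriple is101 (0 ∷ r) z ≡ false) → Descended101 y (r ++ [ y ])
summary101-descend {r} {y} valid covers closesBelow = record
  { valid       = valid
  ; last≡       = lastOf-++-[] 0 r y
  ; covers      = λ z z≤sy → occurs-++-[]ˡ (0 ∷ r) y z (covers z z≤sy)
  ; closesBelow = λ z z≤y → trans (closes-101-++-[] (0 ∷ r) y z)
                                  (cong₂ _∨_ (closesBelow z z≤y) (cong (_∧ any (z ≡ᵇ_) (0 ∷ r)) (≥⇒<ᵇ≡false z≤y)))
  ; closesAbove = trans (closes-101-++-[] (0 ∷ r) y (suc y))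
                        (∨-trueʳ _ (cong₂ _∧_ (<⇒<ᵇ≡true (n<1+n y)) (covers (suc y) ≤-refl)))
  }

summary101-rise : ∀ {v r y} → Ascending101 v r → v ≤ y → y ≤ suc v →
                  catalanAvoiding is101 (0 ∷ (r ++ [ y ])) ≡ true → Ascending101 y (r ++ [ y ])
summary101-rise {v} {r} {y} σ v≤y y≤sv valid′ = record
  { valid      = valid′
  ; last≡      = lastOf-++-[] 0 r y
  ; closesNone = closesNone′
  ; covers     = covers′
  ; bounded    = trans (any-++-[] (y <ᵇ_) (0 ∷ r) y) (cong₂ _∨_ (bounded-mono (0 ∷ r) v≤y bounded) (<ᵇ-irrefl y))
  }
  where
  open Ascending101 σ
  closesNone′ : ∀ z → closesTriple is101 (0 ∷ (r ++ [ y ])) z ≡ false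
  closesNone′ z = trans (closes-101-++-[] (0 ∷ r) y z) (cong₂ _∨_ (closesNone z) fresh)
    where
    fresh : (y <ᵇ z) ∧ any (z ≡ᵇ_) (0 ∷ r) ≡ false
    fresh with any (z ≡ᵇ_) (0 ∷ r) in occurs
    ... | true  = cong (_∧ true) (≥⇒<ᵇ≡false {y} {z} (≤-trans (occurs-≤ (0 ∷ r) occurs bounded) v≤y))
    ... | false = ∧-zeroʳ _
  covers′ : ∀ z → z ≤ y → any (z ≡ᵇ_) (0 ∷ (r ++ [ y ])) ≡ true
  covers′ z z≤y with z ≤? v
  ... | yes z≤v = occurs-++-[]ˡ (0 ∷ r) y z (covers z z≤v)
  ... | no  z≰v = subst (λ x → any (x ≡ᵇ_) (0 ∷ (r ++ [ y ])) ≡ true) (sym z≡y) (occurs-++-[]ʳ (0 ∷ r) y)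
    where
    z≡y : z ≡ y
    z≡y = ≤-antisym z≤y (≤-trans y≤sv (≰⇒> z≰v))

summary101-next : ∀ {s r} y → Summarises101 s r → allowed101 s y ≡ true → Summarises101 (next101 s y) (r ++ [ y ])
summary101-next {ascending v} {r} y σ allowed with y <ᵇ v in y<v
... | true  = summary101-descend (summary101-extend y σ allowed)
                (λ z z≤sy → Ascending101.covers σ z (≤-trans z≤sy (<ᵇ≡true⇒< y<v))) (λ z _ → Ascending101.closesNone σ z)
... | false = summary101-rise σ (<ᵇ≡false⇒≥ y<v) (≤ᵇ≡true⇒≤ allowed) (summary101-extend y σ allowed)
summary101-next {descended v} {r} y σ allowed = summary101-descend (summary101-extend y σ allowed)
  (λ z z≤sy → Descended101.covers σ z (≤-trans z≤sy (s≤s y≤v))) (λ z z≤y → Descended101.closesBelow σ z (≤-trans z≤y y≤v))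
  where
  y≤v : y ≤ v
  y≤v = ≤ᵇ≡true⇒≤ allowed

summary101-initial : Ascending101 0 []
summary101-initial = record
  { valid = refl ; last≡ = refl ; closesNone = λ _ → refl ; covers = λ { zero _ → refl } ; bounded = refl }

module Completions101 = Completions is101 State101 Summarises101 last101 allowed101 next101
  summary101-valid summary101-last summary101-allowed summary101-next

falling rising fallingDescents risingDescents : ℕ → ℕ → ℕ
falling v zero    = 1
falling v (suc m) = ∑[ y < suc v ] falling y m
rising v zero    = 1
rising v (suc m) = ∑[ y < v ] falling y m + rising v m + rising (suc v) m
fallingDescents v zero    = 0
fallingDescents v (suc m) = ∑[ y < suc v ] (boolToℕ (y <ᵇ v) * falling y m + fallingDescents y m)
risingDescents v zero    = 0
risingDescents v (suc m) =
  ∑[ y < v ] (falling y m + fallingDescents y m) + risingDescents v m + risingDescents (suc v) m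

module Evaluate101 (b : ℕ) where
  open Completions101 b

  below-< : ∀ {y v m} → y ≤ v → v + suc m < b → y + m < b
  below-< {y} {v} {m} y≤v lt = ≤-<-trans (+-monoˡ-≤ m y≤v) (drop-< v (shift-< v lt))

  ∑<-descended : ∀ {v m} (g : ℕ → ℕ) → v + suc m < b → (∀ y → v < y → g y ≡ 0) → ∑< b g ≡ ∑< (suc v) g
  ∑<-descended {v} {m} g lt above = ∑<-truncate g (≤-trans (s≤s (m≤m+n v (suc m))) lt) above

  ∑<-ascending : ∀ {v m} (g : ℕ → ℕ) → v + suc m < b → (∀ y → suc v < y → g y ≡ 0) →
                 ∑< b g ≡ ∑< v g + g v + g (suc v)
  ∑<-ascending {v} g lt above = begin
    ∑< b g                          ≡⟨ ∑<-truncate g (2+≤ v lt) above ⟩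
    ∑< (suc (suc v)) g              ≡⟨ ∑<-suc (suc v) g ⟩
    ∑< (suc v) g + g (suc v)        ≡⟨ cong (_+ g (suc v)) (∑<-suc v g) ⟩
    ∑< v g + g v + g (suc v)        ∎
    where open ≡-Reasoning

  completions-descended : ∀ m v → v + m < b → completions (descended v) m ≡ falling v m
  completions-descended zero    v _  = refl
  completions-descended (suc m) v lt =
    trans (∑<-descended _ lt (λ y v<y → if-false (>⇒≤ᵇ≡false v<y)))
          (∑<-cong (suc v) (λ y y<sv → trans (if-true {y = 0} (≤⇒≤ᵇ≡true (≤-pred y<sv)))
                                              (completions-descended m y (below-< (≤-pred y<sv) lt))))

  completions-ascending : ∀ m v → v + m < b → completions (ascending v) m ≡ rising v m
  completions-ascending zero    v _  = refl
  completions-ascending (suc m) v lt =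
    trans (∑<-ascending _ lt (λ y sv<y → if-false (>⇒≤ᵇ≡false sv<y)))
          (cong₂ _+_ (cong₂ _+_ (∑<-cong v falls) stays) rises)
    where
    falls : ∀ y → y < v → term m (ascending v) y ≡ falling y m
    falls y y<v rewrite ≤⇒≤ᵇ≡true (≤-trans (<⇒≤ y<v) (n≤1+n v)) | <⇒<ᵇ≡true y<v =
      completions-descended m y (below-< (<⇒≤ y<v) lt)
    stays : term m (ascending v) v ≡ rising v m
    stays rewrite ≤⇒≤ᵇ≡true (n≤1+n v) | <ᵇ-irrefl v = completions-ascending m v (drop-< v (shift-< v lt))
    rises : term m (ascending v) (suc v) ≡ rising (suc v) m
    rises rewrite ≤⇒≤ᵇ≡true {suc v} ≤-refl | ≥⇒<ᵇ≡false (n≤1+n v) = completions-ascending m (suc v) (shift-< v lt)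

  descents-descended : ∀ m v → v + m < b → completionDescents (descended v) m ≡ fallingDescents v m
  descents-descended zero    v _  = refl
  descents-descended (suc m) v lt =
    trans (∑<-descended _ lt (λ y v<y → if-false (>⇒≤ᵇ≡false v<y)))
          (∑<-cong (suc v) (λ y y<sv → trans (if-true {y = 0} (≤⇒≤ᵇ≡true (≤-pred y<sv)))
            (cong₂ (λ c d → boolToℕ (y <ᵇ v) * c + d)
                   (completions-descended m y (below-< (≤-pred y<sv) lt)) (descents-descended m y (below-< (≤-pred y<sv) lt)))))

  descents-ascending : ∀ m v → v + m < b → completionDescents (ascending v) m ≡ risingDescents v m
  descents-ascending zero    v _  = refl
  descents-ascending (suc m) v lt =
    trans (∑<-ascending _ lt (λ y sv<y → if-false (>⇒≤ᵇ≡false sv<y)))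
          (cong₂ _+_ (cong₂ _+_ (∑<-cong v falls) stays) rises)
    where
    falls : ∀ y → y < v → descentTerm m (ascending v) y ≡ falling y m + fallingDescents y m
    falls y y<v rewrite ≤⇒≤ᵇ≡true (≤-trans (<⇒≤ y<v) (n≤1+n v)) | <⇒<ᵇ≡true y<v =
      cong₂ _+_ (trans (*-identityˡ _) (completions-descended m y (below-< (<⇒≤ y<v) lt)))
                (descents-descended m y (below-< (<⇒≤ y<v) lt))
    stays : descentTerm m (ascending v) v ≡ risingDescents v m
    stays rewrite ≤⇒≤ᵇ≡true (n≤1+n v) | <ᵇ-irrefl v = descents-ascending m v (drop-< v (shift-< v lt))
    rises : descentTerm m (ascending v) (suc v) ≡ risingDescents (suc v) m
    rises rewrite ≤⇒≤ᵇ≡true {suc v} ≤-refl | ≥⇒<ᵇ≡false (n≤1+n v) = descents-ascending m (suc v) (shift-< v lt)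

mutual
  falling+rising : ∀ m v → falling v m + rising (suc (suc v)) m ≡ rising v m + rising (suc v) m
  falling+rising zero    v = refl
  falling+rising (suc k) v = begin
    falling v (suc k) + rising (2 + v) (suc k)
      ≡⟨ cong (_+_ (falling v (suc k))) (rising-suc k (suc v)) ⟩
    falling v (suc k) + (rising (suc v) (suc k) + rising (2 + v) k)
      ≡⟨ cong (λ x → falling v (suc k) + (x + rising (2 + v) k)) (rising-suc k v) ⟩
    falling v (suc k) + ((rising v (suc k) + rising (suc v) k) + rising (2 + v) k)
      ≡⟨ regroup (falling v (suc k)) (rising v (suc k)) (rising (suc v) k) (rising (2 + v) k) ⟩
    rising v (suc k) + rising (suc v) (suc k) ∎
    where
    open ≡-Reasoning
    regroup : ∀ e i a c → e + ((i + a) + c) ≡ i + ((e + a) + c)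
    regroup = solve-∀

  rising-suc : ∀ m v → rising (suc v) (suc m) ≡ rising v (suc m) + rising (suc v) m
  rising-suc m v = begin
    S (suc v) + rising (suc v) m + rising (2 + v) m
      ≡⟨ cong (λ x → x + rising (suc v) m + rising (2 + v) m) (∑<-suc v (λ y → falling y m)) ⟩
    (S v + falling v m) + rising (suc v) m + rising (2 + v) m
      ≡⟨ regroup₁ (S v) (falling v m) (rising (suc v) m) (rising (2 + v) m) ⟩
    S v + rising (suc v) m + (falling v m + rising (2 + v) m)
      ≡⟨ cong (_+_ (S v + rising (suc v) m)) (falling+rising m v) ⟩
    S v + rising (suc v) m + (rising v m + rising (suc v) m)
      ≡⟨ regroup₂ (S v) (rising v m) (rising (suc v) m) ⟩
    (S v + rising v m + rising (suc v) m) + rising (suc v) m ∎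
    where
    open ≡-Reasoning
    regroup₁ : ∀ s e a c → (s + e) + a + c ≡ s + a + (e + c)
    regroup₁ = solve-∀
    regroup₂ : ∀ s i a → s + a + (i + a) ≡ (s + i + a) + a
    regroup₂ = solve-∀
    S : ℕ → ℕ
    S v = ∑[ y < v ] falling y m

rising≡count : ∀ m → (rising 0 m ≡ countA m) × (rising 1 m ≡ countB m)
rising≡count zero    = refl , refl
rising≡count (suc m) with rising≡count m
... | r₀ , r₁ = level , trans (rising-suc m 0) (cong₂ _+_ level r₁)
  where
  level : rising 0 (suc m) ≡ countA (suc m)
  level = cong₂ _+_ r₀ r₁

falling+fallingDescents : ∀ v k → falling v (suc k) + fallingDescents v (suc k) ≡
  ∑[ y < suc v ] (falling y k + fallingDescents y k) + ∑[ y < v ] falling y k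
falling+fallingDescents v k = begin
  falling v (suc k) + fallingDescents v (suc k)
    ≡⟨ cong (_+_ (falling v (suc k))) (∑<-distrib-+ (suc v) (λ y → boolToℕ (y <ᵇ v) * falling y k) (λ y → fallingDescents y k)) ⟩
  falling v (suc k) + (∑[ y < suc v ] (boolToℕ (y <ᵇ v) * falling y k) + D)
    ≡⟨ cong (λ x → falling v (suc k) + (x + D)) strictlyBelow ⟩
  falling v (suc k) + (∑[ y < v ] falling y k + 0 + D)
    ≡⟨ regroup (falling v (suc k)) (∑[ y < v ] falling y k) D ⟩
  (falling v (suc k) + D) + ∑[ y < v ] falling y k
    ≡⟨ cong (_+ ∑[ y < v ] falling y k) (sym (∑<-distrib-+ (suc v) (λ y → falling y k) (λ y → fallingDescents y k))) ⟩
  ∑[ y < suc v ] (falling y k + fallingDescents y k) + ∑[ y < v ] falling y k ∎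
  where
  open ≡-Reasoning
  D : ℕ
  D = ∑[ y < suc v ] fallingDescents y k
  regroup : ∀ e s d → e + ((s + 0) + d) ≡ (e + d) + s
  regroup = solve-∀
  strictlyBelow : ∑[ y < suc v ] (boolToℕ (y <ᵇ v) * falling y k) ≡ ∑[ y < v ] falling y k + 0
  strictlyBelow = trans (∑<-suc v _) (cong₂ _+_
    (∑<-cong v (λ y y<v → trans (cong (λ c → boolToℕ c * falling y k) (<⇒<ᵇ≡true y<v)) (*-identityˡ _)))
    (cong (λ c → boolToℕ c * falling v k) (<ᵇ-irrefl v)))

mutual
  falling+risingDescents : ∀ m v → falling v m + fallingDescents v m + risingDescents (suc (suc v)) m ≡
                                   risingDescents v m + risingDescents (suc v) m + rising v m
  falling+risingDescents zero    v = refl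
  falling+risingDescents (suc k) v = begin
    falling v (suc k) + fallingDescents v (suc k) + risingDescents (2 + v) (suc k)
      ≡⟨ cong (_+_ (falling v (suc k) + fallingDescents v (suc k))) (risingDescents-suc k (suc v)) ⟩
    falling v (suc k) + fallingDescents v (suc k) + (risingDescents (suc v) (suc k) + risingDescents (2 + v) k + rising (suc v) k)
      ≡⟨ cong (λ x → falling v (suc k) + fallingDescents v (suc k) + (x + risingDescents (2 + v) k + rising (suc v) k))
              (risingDescents-suc k v) ⟩
    falling v (suc k) + fallingDescents v (suc k)
      + ((risingDescents v (suc k) + risingDescents (suc v) k + rising v k) + risingDescents (2 + v) k + rising (suc v) k)
      ≡⟨ cong (_+ ((risingDescents v (suc k) + risingDescents (suc v) k + rising v k) + risingDescents (2 + v) k + rising (suc v) k))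
              (falling+fallingDescents v k) ⟩
    (Sd (suc v) + S v) + ((risingDescents v (suc k) + risingDescents (suc v) k + rising v k) + risingDescents (2 + v) k + rising (suc v) k)
      ≡⟨ regroup (Sd (suc v)) (S v) (risingDescents v (suc k)) (risingDescents (suc v) k)
                 (rising v k) (risingDescents (2 + v) k) (rising (suc v) k) ⟩
    risingDescents v (suc k) + risingDescents (suc v) (suc k) + rising v (suc k) ∎
    where
    open ≡-Reasoning
    S Sd : ℕ → ℕ
    S v = ∑[ y < v ] falling y k
    Sd v = ∑[ y < v ] (falling y k + fallingDescents y k)
    regroup : ∀ sd s dv d1 iv d2 i1 → (sd + s) + ((dv + d1 + iv) + d2 + i1) ≡ dv + (sd + d1 + d2) + (s + iv + i1)
    regroup = solve-∀

  risingDescents-suc : ∀ m v → risingDescents (suc v) (suc m) ≡ risingDescents v (suc m) + risingDescents (suc v) m + rising v m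
  risingDescents-suc m v = begin
    Sd (suc v) + risingDescents (suc v) m + risingDescents (2 + v) m
      ≡⟨ cong (λ x → x + risingDescents (suc v) m + risingDescents (2 + v) m) (∑<-suc v (λ y → falling y m + fallingDescents y m)) ⟩
    (Sd v + (falling v m + fallingDescents v m)) + risingDescents (suc v) m + risingDescents (2 + v) m
      ≡⟨ regroup₁ (Sd v) (falling v m + fallingDescents v m) (risingDescents (suc v) m) (risingDescents (2 + v) m) ⟩
    Sd v + risingDescents (suc v) m + (falling v m + fallingDescents v m + risingDescents (2 + v) m)
      ≡⟨ cong (_+_ (Sd v + risingDescents (suc v) m)) (falling+risingDescents m v) ⟩
    Sd v + risingDescents (suc v) m + (risingDescents v m + risingDescents (suc v) m + rising v m)
      ≡⟨ regroup₂ (Sd v) (risingDescents v m) (risingDescents (suc v) m) (rising v m) ⟩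
    (Sd v + risingDescents v m + risingDescents (suc v) m) + risingDescents (suc v) m + rising v m ∎
    where
    open ≡-Reasoning
    Sd : ℕ → ℕ
    Sd v = ∑[ y < v ] (falling y m + fallingDescents y m)
    regroup₁ : ∀ s e a c → (s + e) + a + c ≡ s + a + (e + c)
    regroup₁ = solve-∀
    regroup₂ : ∀ s i a j → s + a + (i + a + j) ≡ (s + i + a) + a + j
    regroup₂ = solve-∀

risingDescents≡desc : ∀ m → (risingDescents 0 m ≡ descA m) × (risingDescents 1 m ≡ descB m)
risingDescents≡desc zero    = refl , refl
risingDescents≡desc (suc m) with risingDescents≡desc m
... | d₀ , d₁ = level , trans (risingDescents-suc m 0) (cong₂ _+_ (cong₂ _+_ level d₁) (proj₁ (rising≡count m)))
  where
  level : risingDescents 0 (suc m) ≡ descA (suc m)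
  level = cong₂ _+_ d₀ d₁

module Avoiders101 = CatalanAvoiders (1 ∷ 0 ∷ 1 ∷ []) is101 (contains-triple is101 orderIso-101)

length-Cat-101 : ∀ m → length (Cat (suc m) (1 ∷ 0 ∷ 1 ∷ [])) ≡ countA m
length-Cat-101 m = trans (Avoiders101.length-Cat m)
  (trans (Completions101.completions-correct (suc m) m summary101-initial)
  (trans (Evaluate101.completions-ascending (suc m) m 0 ≤-refl) (proj₁ (rising≡count m))))

descents-Cat-101 : ∀ m → sum (map des (Cat (suc m) (1 ∷ 0 ∷ 1 ∷ []))) ≡ descA m
descents-Cat-101 m = trans (Avoiders101.descents-Cat m)
  (trans (Completions101.completionDescents-correct (suc m) m summary101-initial)
  (trans (Evaluate101.descents-ascending (suc m) m 0 ≤-refl) (proj₁ (risingDescents≡desc m))))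

binomEven binomOdd : ℕ → ℕ → ℕ
binomEven m k = (m + k) C (2 * k)
binomOdd  m k = (m + k) C suc (2 * k)

2*suc : ∀ k → 2 * suc k ≡ suc (suc (2 * k))
2*suc = solve-∀

binomEven-suc : ∀ m k → binomEven (suc m) (suc k) ≡ binomEven m (suc k) + binomOdd (suc m) k
binomEven-suc m k = begin
  (suc m + suc k) C (2 * suc k)                       ≡⟨ cong₂ _C_ (cong suc (+-suc m k)) (2*suc k) ⟩
  suc (suc (m + k)) C suc (suc (2 * k))               ≡⟨ sym (nCk+nC[k+1]≡[n+1]C[k+1] (suc (m + k)) (suc (2 * k))) ⟩
  suc (m + k) C suc (2 * k) + suc (m + k) C (suc (suc (2 * k)))
                                                      ≡⟨ +-comm (suc (m + k) C suc (2 * k)) _ ⟩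
  suc (m + k) C (suc (suc (2 * k))) + suc (m + k) C suc (2 * k)
                                                      ≡⟨ cong (_+ binomOdd (suc m) k) (sym (cong₂ _C_ (+-suc m k) (2*suc k))) ⟩
  binomEven m (suc k) + binomOdd (suc m) k            ∎
  where open ≡-Reasoning

binomOdd-suc : ∀ m k → binomOdd (suc m) k ≡ binomEven m k + binomOdd m k
binomOdd-suc m k = sym (nCk+nC[k+1]≡[n+1]C[k+1] (m + k) (2 * k))

binomEven-vanishes : ∀ m k → m < k → binomEven m k ≡ 0
binomEven-vanishes m k m<k = k>n⇒nCk≡0 (subst (m + k <_) (sym (*-two k)) (+-monoˡ-< k m<k))
  where
  *-two : ∀ k → 2 * k ≡ k + k
  *-two = solve-∀

binomOdd-vanishes : ∀ m k → m ≤ k → binomOdd m k ≡ 0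
binomOdd-vanishes m k m≤k = k>n⇒nCk≡0 (s≤s (subst (m + k ≤_) (sym (*-two k)) (+-monoˡ-≤ k m≤k)))
  where
  *-two : ∀ k → 2 * k ≡ k + k
  *-two = solve-∀

-- Truncating at a fixed L ≥ m loses nothing (the terms with k > m vanish) and keeps the
-- range of summation independent of m along the induction.
module BinomialSums (L : ℕ) where
  evenSum oddSum evenMoment oddMoment : ℕ → ℕ
  evenSum    m = ∑[ k < suc L ] binomEven m k
  oddSum     m = ∑[ k < suc L ] binomOdd m k
  evenMoment m = ∑[ k < suc L ] (k * binomEven m k)
  oddMoment  m = ∑[ k < suc L ] (k * binomOdd m k)

  oddSum-drop-last : ∀ m → suc m ≤ L → oddSum (suc m) ≡ ∑[ k < L ] binomOdd (suc m) k
  oddSum-drop-last m h = trans (∑<-suc L (binomOdd (suc m)))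
    (trans (cong (_+_ (∑[ k < L ] binomOdd (suc m) k)) (binomOdd-vanishes (suc m) L h)) (+-identityʳ _))

  oddMoment-drop-last : ∀ m → suc m ≤ L → oddMoment (suc m) ≡ ∑[ k < L ] (k * binomOdd (suc m) k)
  oddMoment-drop-last m h = trans (∑<-suc L (λ k → k * binomOdd (suc m) k))
    (trans (cong (λ z → ∑[ k < L ] (k * binomOdd (suc m) k) + L * z) (binomOdd-vanishes (suc m) L h))
    (trans (cong (_+_ (∑[ k < L ] (k * binomOdd (suc m) k))) (*-zeroʳ L)) (+-identityʳ _)))

  evenSum-suc : ∀ m → suc m ≤ L → evenSum (suc m) ≡ evenSum m + oddSum (suc m)
  evenSum-suc m h = begin
    1 + ∑[ k < L ] binomEven (suc m) (suc k)
      ≡⟨ cong (_+_ 1) (∑<-cong L (λ k _ → binomEven-suc m k)) ⟩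
    1 + ∑[ k < L ] (binomEven m (suc k) + binomOdd (suc m) k)
      ≡⟨ cong (_+_ 1) (∑<-distrib-+ L (λ k → binomEven m (suc k)) (binomOdd (suc m))) ⟩
    1 + (∑[ k < L ] binomEven m (suc k) + ∑[ k < L ] binomOdd (suc m) k)
      ≡⟨ sym (+-assoc 1 (∑[ k < L ] binomEven m (suc k)) (∑[ k < L ] binomOdd (suc m) k)) ⟩
    evenSum m + ∑[ k < L ] binomOdd (suc m) k
      ≡⟨ cong (_+_ (evenSum m)) (sym (oddSum-drop-last m h)) ⟩
    evenSum m + oddSum (suc m) ∎
    where open ≡-Reasoning

  oddSum-suc : ∀ m → oddSum (suc m) ≡ evenSum m + oddSum m
  oddSum-suc m = trans (∑<-cong (suc L) (λ k _ → binomOdd-suc m k)) (∑<-distrib-+ (suc L) (binomEven m) (binomOdd m))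

  oddMoment-suc : ∀ m → oddMoment (suc m) ≡ evenMoment m + oddMoment m
  oddMoment-suc m = trans (∑<-cong (suc L) (λ k _ → trans (cong (k *_) (binomOdd-suc m k)) (*-distribˡ-+ k (binomEven m k) (binomOdd m k))))
                          (∑<-distrib-+ (suc L) (λ k → k * binomEven m k) (λ k → k * binomOdd m k))

  evenMoment-suc : ∀ m → suc m ≤ L → evenMoment (suc m) ≡ evenMoment m + oddMoment (suc m) + oddSum (suc m)
  evenMoment-suc m h = begin
    ∑[ k < L ] (suc k * binomEven (suc m) (suc k))
      ≡⟨ ∑<-cong L (λ k _ → trans (cong (suc k *_) (binomEven-suc m k))
                                  (*-distribˡ-+ (suc k) (binomEven m (suc k)) (binomOdd (suc m) k))) ⟩
    ∑[ k < L ] (suc k * binomEven m (suc k) + suc k * binomOdd (suc m) k)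
      ≡⟨ ∑<-distrib-+ L (λ k → suc k * binomEven m (suc k)) (λ k → suc k * binomOdd (suc m) k) ⟩
    evenMoment m + ∑[ k < L ] (binomOdd (suc m) k + k * binomOdd (suc m) k)
      ≡⟨ cong (_+_ (evenMoment m)) (∑<-distrib-+ L (binomOdd (suc m)) (λ k → k * binomOdd (suc m) k)) ⟩
    evenMoment m + (∑[ k < L ] binomOdd (suc m) k + ∑[ k < L ] (k * binomOdd (suc m) k))
      ≡⟨ cong₂ (λ x y → evenMoment m + (x + y)) (sym (oddSum-drop-last m h)) (sym (oddMoment-drop-last m h)) ⟩
    evenMoment m + (oddSum (suc m) + oddMoment (suc m))
      ≡⟨ regroup (evenMoment m) (oddSum (suc m)) (oddMoment (suc m)) ⟩
    evenMoment m + oddMoment (suc m) + oddSum (suc m) ∎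
    where
    open ≡-Reasoning
    regroup : ∀ p b q → p + (b + q) ≡ p + q + b
    regroup = solve-∀

  binomialSums : ∀ m → m ≤ L →
    (countA m ≡ evenSum m) × (countB m ≡ oddSum (suc m)) ×
    (descA (suc m) ≡ evenMoment m) × (descB (suc m) ≡ oddMoment (suc m) + oddSum (suc m))
  binomialSums zero _ = sym evenSum₀ , sym oddSum₁ , sym evenMoment₀ , sym (cong₂ _+_ oddMoment₁ oddSum₁)
    where
    evenSum₀ : evenSum 0 ≡ 1
    evenSum₀ = cong (_+_ 1) (∑<-zero L (λ k _ → binomEven-vanishes 0 (suc k) z<s))
    oddSum₁ : oddSum 1 ≡ 1
    oddSum₁ = cong (_+_ 1) (∑<-zero L (λ k _ → binomOdd-vanishes 1 (suc k) (s≤s z≤n)))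
    evenMoment₀ : evenMoment 0 ≡ 0
    evenMoment₀ = ∑<-zero L (λ k _ → trans (cong (suc k *_) (binomEven-vanishes 0 (suc k) z<s)) (*-zeroʳ (suc k)))
    oddMoment₁ : oddMoment 1 ≡ 0
    oddMoment₁ = ∑<-zero L (λ k _ → trans (cong (suc k *_) (binomOdd-vanishes 1 (suc k) (s≤s z≤n))) (*-zeroʳ (suc k)))
  binomialSums (suc m) h with binomialSums m (≤-trans (n≤1+n m) h)
  ... | a , b , c , e = a′ , b′ , c′ , e′
    where
    a′ : countA (suc m) ≡ evenSum (suc m)
    a′ = trans (cong₂ _+_ a b) (sym (evenSum-suc m h))
    b′ : countB (suc m) ≡ oddSum (suc (suc m))
    b′ = trans (cong₂ _+_ a′ b) (sym (oddSum-suc (suc m)))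
    c′ : descA (suc (suc m)) ≡ evenMoment (suc m)
    c′ = trans (cong₂ _+_ c e) (trans (sym (+-assoc (evenMoment m) _ _)) (sym (evenMoment-suc m h)))
    e′ : descB (suc (suc m)) ≡ oddMoment (suc (suc m)) + oddSum (suc (suc m))
    e′ = begin
      descA (suc m) + descB (suc m) + descB (suc m) + countA (suc m)
        ≡⟨ cong₂ _+_ (cong₂ _+_ (cong₂ _+_ c e) e) a′ ⟩
      evenMoment m + (oddMoment (suc m) + oddSum (suc m)) + (oddMoment (suc m) + oddSum (suc m)) + evenSum (suc m)
        ≡⟨ regroup (evenMoment m) (oddMoment (suc m)) (oddSum (suc m)) (evenSum (suc m)) ⟩
      (evenMoment m + oddMoment (suc m) + oddSum (suc m) + oddMoment (suc m)) + (evenSum (suc m) + oddSum (suc m))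
        ≡⟨ cong₂ _+_ (trans (cong (_+ oddMoment (suc m)) (sym (evenMoment-suc m h))) (sym (oddMoment-suc (suc m))))
                     (sym (oddSum-suc (suc m))) ⟩
      oddMoment (suc (suc m)) + oddSum (suc (suc m)) ∎
      where
      open ≡-Reasoning
      regroup : ∀ p q b a → p + (q + b) + (q + b) + a ≡ (p + q + b + q) + (a + b)
      regroup = solve-∀

descentSum≡descA : ∀ m → descentSum (suc m) ≡ descA m
descentSum≡descA zero    = refl
descentSum≡descA (suc m) = begin
  descentSum (suc (suc m))
    ≡⟨ sum-map-applyUpTo (λ k → k) _ m ⟩
  ∑[ i < m ] (suc i * binomEven m (suc i))
    ≡⟨ sym (+-identityʳ _) ⟩
  ∑[ i < m ] (suc i * binomEven m (suc i)) + 0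
    ≡⟨ cong (_+_ (∑[ i < m ] (suc i * binomEven m (suc i))))
            (sym (trans (cong (suc m *_) (binomEven-vanishes m (suc m) ≤-refl)) (*-zeroʳ (suc m)))) ⟩
  ∑[ i < m ] (suc i * binomEven m (suc i)) + suc m * binomEven m (suc m)
    ≡⟨ sym (∑<-suc m (λ i → suc i * binomEven m (suc i))) ⟩
  BinomialSums.evenMoment (suc m) m
    ≡⟨ sym (proj₁ (proj₂ (proj₂ (BinomialSums.binomialSums (suc m) m (n≤1+n m))))) ⟩
  descA (suc m) ∎
  where open ≡-Reasoning

count≡fib : ∀ m → (countA m ≡ fib (suc (2 * m))) × (countB m ≡ fib (suc (suc (2 * m))))
count≡fib zero    = refl , refl
count≡fib (suc m) with count≡fib m
... | a , b = a′ , b′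
  where
  a′ : countA (suc m) ≡ fib (suc (2 * suc m))
  a′ = trans (trans (cong₂ _+_ a b) (+-comm (fib (suc (2 * m))) _)) (cong (λ z → fib (suc z)) (sym (2*suc m)))
  b′ : countB (suc m) ≡ fib (suc (suc (2 * suc m)))
  b′ = trans (cong₂ _+_ (cong₂ _+_ a b) b)
             (trans (regroup (fib (suc (2 * m))) (fib (suc (suc (2 * m)))))
                    (cong (λ z → fib (suc (suc z))) (sym (2*suc m))))
    where
    regroup : ∀ x y → x + y + y ≡ y + x + y
    regroup = solve-∀

countA-recurrence : ∀ k → countA (2 + k) + countA k ≡ 3 * countA (suc k)
countA-recurrence k = unfolded (countA k) (countB k)
  where
  unfolded : ∀ a b → (a + b) + (a + b + b) + a ≡ 3 * (a + b)
  unfolded = solve-∀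

-- Four steps of the recurrences express every term through countA k, countB k, descA k, descB k.
descA-recurrence : ∀ k → descA (4 + k) + 11 * descA (2 + k) + descA k ≡ 6 * descA (3 + k) + 6 * descA (1 + k)
descA-recurrence k = unfolded (countA k) (countB k) (descA k) (descB k)
  where
  unfolded : ∀ a b c e →
    let c₁ = c + e ; e₁ = c + e + e + a ; a₁ = a + b ; b₁ = a + b + b
        c₂ = c₁ + e₁ ; e₂ = c₁ + e₁ + e₁ + a₁ ; a₂ = a₁ + b₁
        c₃ = c₂ + e₂ ; e₃ = c₂ + e₂ + e₂ + a₂
    in c₃ + e₃ + 11 * c₂ + c ≡ 6 * c₃ + 6 * c₁
  unfolded = solve-∀

sumℤ-vanishing : ∀ (f : ℕ → ℤ) (g : ℕ → ℕ) k → (∀ x → f (g x) ≡ ℤ.0ℤ) → sumℤ (map f (applyUpTo g k)) ≡ ℤ.0ℤ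
sumℤ-vanishing f g zero    _      = refl
sumℤ-vanishing f g (suc k) vanish rewrite vanish 0 | sumℤ-vanishing f (g ∘ suc) k (vanish ∘ suc) = refl

+-minus-+ : ∀ {p q} → p ≡ q → + p ℤ.- + q ≡ ℤ.0ℤ
+-minus-+ {q = q} refl = ℤₚ.+-inverseʳ (+ q)

countGF : (a : ℕ → ℕ) → a 0 ≡ 1 → (∀ m → a (suc m) ≡ countA m) →
          hasGF (λ n → + a n) (+ 1 ∷ - (+ 2) ∷ []) (+ 1 ∷ - (+ 3) ∷ + 1 ∷ [])
countGF a a₀ a-suc zero          rewrite a₀ = refl
countGF a a₀ a-suc (suc zero)    rewrite a₀ | a-suc 0 = refl
countGF a a₀ a-suc (suc (suc k)) = begin
  sumℤ (map term (upTo (3 + k)))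
    ≡⟨ cong (λ t → term 0 ℤ.+ (term 1 ℤ.+ (term 2 ℤ.+ t))) (sumℤ-vanishing term (_+_ 3) k (λ _ → refl)) ⟩
  + 1 ℤ.* + a (2 + k) ℤ.+ (- (+ 3) ℤ.* + a (1 + k) ℤ.+ (+ 1 ℤ.* + a k ℤ.+ ℤ.0ℤ))
    ≡⟨ regroup (+ a (2 + k)) (+ a (1 + k)) (+ a k) ⟩
  (+ a (2 + k) ℤ.+ + a k) ℤ.- + 3 ℤ.* + a (1 + k)
    ≡⟨ cong₂ ℤ._-_ (sym (ℤₚ.pos-+ (a (2 + k)) (a k))) (sym (ℤₚ.pos-* 3 (a (1 + k)))) ⟩
  + (a (2 + k) + a k) ℤ.- + (3 * a (1 + k))
    ≡⟨ +-minus-+ (recurrence k) ⟩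
  ℤ.0ℤ ∎
  where
  open ≡-Reasoning
  term : ℕ → ℤ
  term j = coeff (+ 1 ∷ - (+ 3) ∷ + 1 ∷ []) j ℤ.* + a (2 + k ∸ j)
  regroup : ∀ x y z → + 1 ℤ.* x ℤ.+ (- (+ 3) ℤ.* y ℤ.+ (+ 1 ℤ.* z ℤ.+ ℤ.0ℤ)) ≡ (x ℤ.+ z) ℤ.- + 3 ℤ.* y
  regroup = solveℤ-∀
  recurrence : ∀ k → a (2 + k) + a k ≡ 3 * a (1 + k)
  recurrence zero    rewrite a-suc 1 | a-suc 0 | a₀ = refl
  recurrence (suc j) rewrite a-suc (2 + j) | a-suc (1 + j) | a-suc j = countA-recurrence j

descentSumGF : hasGF (λ n → + descentSum n) (+ 0 ∷ + 0 ∷ + 0 ∷ + 1 ∷ - (+ 1) ∷ [])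
                     (polyMul (+ 1 ∷ - (+ 3) ∷ + 1 ∷ []) (+ 1 ∷ - (+ 3) ∷ + 1 ∷ []))
descentSumGF 0 = refl
descentSumGF 1 = refl
descentSumGF 2 = refl
descentSumGF 3 = refl
descentSumGF 4 = refl
descentSumGF (suc (suc (suc (suc (suc k))))) = begin
  sumℤ (map term (upTo (5 + suc k)))
    ≡⟨ cong (λ t → term 0 ℤ.+ (term 1 ℤ.+ (term 2 ℤ.+ (term 3 ℤ.+ (term 4 ℤ.+ t)))))
            (sumℤ-vanishing term (_+_ 5) (suc k) (λ _ → refl)) ⟩
  + 1 ℤ.* + d₄ ℤ.+ (- (+ 6) ℤ.* + d₃ ℤ.+ (+ 11 ℤ.* + d₂ ℤ.+ (- (+ 6) ℤ.* + d₁ ℤ.+ (+ 1 ℤ.* + d₀ ℤ.+ ℤ.0ℤ))))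
    ≡⟨ regroup (+ d₄) (+ d₃) (+ d₂) (+ d₁) (+ d₀) ⟩
  (+ d₄ ℤ.+ + 11 ℤ.* + d₂ ℤ.+ + d₀) ℤ.- (+ 6 ℤ.* + d₃ ℤ.+ + 6 ℤ.* + d₁)
    ≡⟨ cong₂ ℤ._-_ (sym (embed₁ d₄ d₂ d₀)) (sym (embed₂ d₃ d₁)) ⟩
  + (d₄ + 11 * d₂ + d₀) ℤ.- + (6 * d₃ + 6 * d₁)
    ≡⟨ +-minus-+ recurrence ⟩
  ℤ.0ℤ ∎
  where
  open ≡-Reasoning
  d₀ d₁ d₂ d₃ d₄ : ℕ
  d₀ = descentSum (suc k)
  d₁ = descentSum (suc (suc k))
  d₂ = descentSum (suc (suc (suc k)))
  d₃ = descentSum (suc (suc (suc (suc k))))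
  d₄ = descentSum (suc (suc (suc (suc (suc k)))))
  term : ℕ → ℤ
  term j = coeff (polyMul (+ 1 ∷ - (+ 3) ∷ + 1 ∷ []) (+ 1 ∷ - (+ 3) ∷ + 1 ∷ [])) j
             ℤ.* + descentSum (suc (suc (suc (suc (suc k)))) ∸ j)
  regroup : ∀ x₄ x₃ x₂ x₁ x₀ →
    + 1 ℤ.* x₄ ℤ.+ (- (+ 6) ℤ.* x₃ ℤ.+ (+ 11 ℤ.* x₂ ℤ.+ (- (+ 6) ℤ.* x₁ ℤ.+ (+ 1 ℤ.* x₀ ℤ.+ ℤ.0ℤ))))
      ≡ (x₄ ℤ.+ + 11 ℤ.* x₂ ℤ.+ x₀) ℤ.- (+ 6 ℤ.* x₃ ℤ.+ + 6 ℤ.* x₁)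
  regroup = solveℤ-∀
  embed₁ : ∀ x y z → + (x + 11 * y + z) ≡ + x ℤ.+ + 11 ℤ.* + y ℤ.+ + z
  embed₁ x y z = trans (ℤₚ.pos-+ (x + 11 * y) z)
                       (cong (ℤ._+ + z) (trans (ℤₚ.pos-+ x (11 * y)) (cong (ℤ._+_ (+ x)) (ℤₚ.pos-* 11 y))))
  embed₂ : ∀ x y → + (6 * x + 6 * y) ≡ + 6 ℤ.* + x ℤ.+ + 6 ℤ.* + y
  embed₂ x y = trans (ℤₚ.pos-+ (6 * x) (6 * y)) (cong₂ ℤ._+_ (ℤₚ.pos-* 6 x) (ℤₚ.pos-* 6 y))
  recurrence : d₄ + 11 * d₂ + d₀ ≡ 6 * d₃ + 6 * d₁
  recurrence = begin
    d₄ + 11 * d₂ + d₀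
      ≡⟨ cong₂ _+_ (cong₂ (λ x y → x + 11 * y) (descentSum≡descA (4 + k)) (descentSum≡descA (2 + k))) (descentSum≡descA k) ⟩
    descA (4 + k) + 11 * descA (2 + k) + descA k
      ≡⟨ descA-recurrence k ⟩
    6 * descA (3 + k) + 6 * descA (1 + k)
      ≡⟨ sym (cong₂ (λ x y → 6 * x + 6 * y) (descentSum≡descA (3 + k)) (descentSum≡descA (1 + k))) ⟩
    6 * d₃ + 6 * d₁ ∎

StatisticsOf : List ℕ → Set
StatisticsOf p =
  hasGF (λ n → + length (Cat n p)) (+ 1 ∷ - (+ 2) ∷ []) (+ 1 ∷ - (+ 3) ∷ + 1 ∷ [])
  × (∀ n → 1 ≤ n → length (Cat n p) ≡ fib (2 * n ∸ 1))
  × (∀ n → sum (map des (Cat n p)) ≡ descentSum n)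
  × hasGF (λ n → + descentSum n)
      (+ 0 ∷ + 0 ∷ + 0 ∷ + 1 ∷ - (+ 1) ∷ [])
      (polyMul (+ 1 ∷ - (+ 3) ∷ + 1 ∷ []) (+ 1 ∷ - (+ 3) ∷ + 1 ∷ []))

statistics : ∀ p → length (Cat 0 p) ≡ 1 → sum (map des (Cat 0 p)) ≡ 0 →
             (∀ m → length (Cat (suc m) p) ≡ countA m) → (∀ m → sum (map des (Cat (suc m) p)) ≡ descA m) →
             StatisticsOf p
statistics p count₀ descents₀ counts descents =
  countGF (λ n → length (Cat n p)) count₀ counts , fibonacci , popularity , descentSumGF
  where
  fibonacci : ∀ n → 1 ≤ n → length (Cat n p) ≡ fib (2 * n ∸ 1)
  fibonacci (suc m) _ = trans (counts m) (trans (proj₁ (count≡fib m)) (cong (λ z → fib (z ∸ 1)) (sym (2*suc m))))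
  popularity : ∀ n → sum (map des (Cat n p)) ≡ descentSum n
  popularity zero    = descents₀
  popularity (suc m) = trans (descents m) (sym (descentSum≡descA m))

corollary6 : (p : List ℕ) → (p ≡ 1 ∷ 2 ∷ 0 ∷ [] ⊎ p ≡ 1 ∷ 0 ∷ 1 ∷ []) →
    hasGF (λ n → + length (Cat n p)) (+ 1 ∷ - (+ 2) ∷ []) (+ 1 ∷ - (+ 3) ∷ + 1 ∷ [])
    × (∀ n → 1 ≤ n → length (Cat n p) ≡ fib (2 * n ∸ 1))
    × (∀ n → sum (map des (Cat n p)) ≡ descentSum n)
    × hasGF (λ n → + descentSum n)
        (+ 0 ∷ + 0 ∷ + 0 ∷ + 1 ∷ - (+ 1) ∷ [])
        (polyMul (+ 1 ∷ - (+ 3) ∷ + 1 ∷ []) (+ 1 ∷ - (+ 3) ∷ + 1 ∷ []))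
corollary6 p (inj₁ refl) = statistics p refl refl length-Cat-120 descents-Cat-120
corollary6 p (inj₂ refl) = statistics p refl refl length-Cat-101 descents-Cat-101
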